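{- For every positive integer $n$, the complete bipartite graph $K_{n,n+1}$ is determined by its resistance spectrum: for every finite simple undirected graph $H$, if $\operatorname{RS}(H)=\operatorname{RS}(K_{n,n+1})$ then $H$ is isomorphic to $K_{n,n+1}$.
   Context: All graphs are finite, simple and undirected. For a graph $G$ and distinct vertices $u,v$, the resistance distance $R_G(u,v)$ is the effective resistance between $u$ and $v$ in the electrical network obtained from $G$ by replacing every edge with a $1\,\Omega$ resistor (it is $+\infty$ if $u$ and $v$ lie in different connected components). The resistance spectrum $\operatorname{RS}(G)$ is the multiset $\{R_G(u,v)\}$ taken over all unordered pairs $\{u,v\}$ of distinct vertices of $G$. A graph $G$ is determined by its resistance spectrum if every graph $H$ with $\operatorname{RS}(H)=\operatorname{RS}(G)$ is isomorphic to $G$. $K_{m,n}$ denotes the complete bipartite graph with parts of sizes $m$ and $n$. -}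

module Defs where

open import Data.Nat using (ℕ; zero; suc; _+_; _<ᵇ_)
open import Data.Fin using (Fin; toℕ; _<_; _≟_)
import Data.Fin as F
open import Data.Bool using (Bool; true; false; if_then_else_; _xor_)
open import Data.Rational using (ℚ; 0ℚ; 1ℚ) renaming (_+_ to _+ℚ_; _-_ to _-ℚ_)
open import Data.Maybe using (Maybe; just; nothing)
open import Data.Product using (Σ; ∃; _×_; _,_)
open import Relation.Binary.PropositionalEquality using (_≡_)
open import Relation.Nullary using (¬_; does)
open import Function.Bundles using (_↔_; Inverse)

record Graph (n : ℕ) : Set where
  field
    adj   : Fin n → Fin n → Bool
    sym   : ∀ i j → adj i j ≡ adj j i
    irefl : ∀ i → adj i i ≡ false
open Graph public

sumFin : (n : ℕ) → (Fin n → ℚ) → ℚ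
sumFin zero    f = 0ℚ
sumFin (suc n) f = f F.zero +ℚ sumFin n (λ i → f (F.suc i))

δ : ∀ {n} → Fin n → Fin n → ℚ
δ u w = if does (w ≟ u) then 1ℚ else 0ℚ

-- (L φ)(w) for the Laplacian L of G (all edges are 1 Ω resistors).
lap : ∀ {n} → Graph n → (Fin n → ℚ) → Fin n → ℚ
lap {n} G φ w = sumFin n (λ x → if adj G w x then φ w -ℚ φ x else 0ℚ)

-- φ is a potential for unit current injected at u and extracted at v
-- (Kirchhoff's current law + Ohm's law): L φ = e_u - e_v.
IsPotential : ∀ {n} → Graph n → Fin n → Fin n → (Fin n → ℚ) → Set
IsPotential G u v φ = ∀ w → lap G φ w ≡ δ u w -ℚ δ v w

-- Resistance distance as a relation into ℚ ∪ {+∞}, with nothing = +∞.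
-- R_G(u,v) = r  iff some unit-current potential φ exists with φ(u) - φ(v) = r
-- (the potential difference is independent of the chosen φ);
-- R_G(u,v) = +∞ iff no such potential exists (u, v in different components).
Resistance : ∀ {n} → Graph n → Fin n → Fin n → Maybe ℚ → Set
Resistance G u v (just r) = Σ _ λ φ → IsPotential G u v φ × (φ u -ℚ φ v ≡ r)
Resistance G u v nothing  = ∀ φ → ¬ IsPotential G u v φ

-- Unordered pairs of distinct vertices, represented as (i , j) with i < j.
Pair : ℕ → Set
Pair n = Σ (Fin n × Fin n) λ { (i , j) → i < j }

ResPair : ∀ {n} → Graph n → Pair n → Maybe ℚ → Set
ResPair G ((i , j) , _) r = Resistance G i j r

-- RS(H) = RS(G) as multisets: a bijection between unordered pairs of
-- distinct vertices preserving the resistance distance.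
SameRS : ∀ {m n} → Graph m → Graph n → Set
SameRS {m} {n} H G =
  Σ (Pair m ↔ Pair n) λ σ →
    ∀ p r → (ResPair H p r → ResPair G (Inverse.to σ p) r)
          × (ResPair G (Inverse.to σ p) r → ResPair H p r)

Isomorphic : ∀ {m n} → Graph m → Graph n → Set
Isomorphic {m} {n} H G =
  Σ (Fin m ↔ Fin n) λ f → ∀ i j → adj H i j ≡ adj G (Inverse.to f i) (Inverse.to f j)

inA : ∀ {k} → ℕ → Fin k → Bool
inA a i = toℕ i <ᵇ a

xor-comm′ : (x y : Bool) → (x xor y) ≡ (y xor x)
xor-comm′ false false = _≡_.refl
xor-comm′ false true  = _≡_.refl
xor-comm′ true  false = _≡_.refl
xor-comm′ true  true  = _≡_.refl

xor-self : (x : Bool) → (x xor x) ≡ false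
xor-self false = _≡_.refl
xor-self true  = _≡_.refl

K : (a b : ℕ) → Graph (a + b)
K a b = record
  { adj   = λ i j → inA a i xor inA a j
  ; sym   = λ i j → xor-comm′ (inA a i) (inA a j)
  ; irefl = λ i → xor-self (inA a i)
  }

-- In K_{n,n+1} every resistance distance is 2/(n+1), except between two vertices of
-- the part of size n+1, where it is 2/n.  A graph H with the same resistance spectrum
-- therefore has 2n+1 vertices and R(u,v) = 2ρ(u,v)/(n(n+1)) with ρ(u,v) ∈ {n, n+1}
-- for u ≠ v; call u and v far when ρ(u,v) = n+1.  Reciprocity of the Laplacian gives,
-- for u ≠ v, the local identity  Σ_{x∼u} (R(u,v) + R(u,x) − R(x,v)) = 2,  i.e. the
-- integer equation
--   (n + [u,v far]) deg u + #{x∼u far from u} + n [u∼v] = n(n+1) + #{x∼u far from v}.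
-- Counting with it shows that adjacent vertices are never far, every degree is n or
-- n+1, vertices of degree n+1 are far from nobody and no edge joins vertices of equal
-- degree.  Comparing the sizes of the two degree classes then forces every vertex to
-- be adjacent to all vertices of the other degree, so H ≅ K_{n,n+1}.

module Submission where

module Combinatorics where

  open import Defs hiding (sym)
  open import Data.Nat as ℕ using (ℕ; zero; suc; _+_; _*_; _≤_; _<_; z≤n; s≤s)
  import Data.Nat.Properties as ℕ
  open import Data.Nat.Solver using (module +-*-Solver)
  open import Data.Fin as Fin using (Fin; _≟_; _↑ˡ_; _↑ʳ_)
  open import Data.Fin.Properties using (any?; +↔⊎; <-cmp; <-irrelevant)
  open import Data.Fin.Permutation using (↔⇒≡)
  open import Data.Bool using (Bool; true; false; not; _∧_; _∨_; _xor_; if_then_else_)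
  open import Data.Bool.Properties using (∨-identityʳ; ∧-zeroʳ; not-involutive) renaming (_≟_ to _≟ᵇ_)
  open import Data.Product using (Σ; _×_; _,_; proj₁; proj₂)
  open import Data.Sum using (_⊎_; inj₁; inj₂; map₁; map₂)
  open import Data.Sum.Function.Propositional using (_⊎-↔_)
  open import Data.Empty using (⊥; ⊥-elim)
  open import Function using (_∘_)
  open import Function.Bundles using (_↔_; Inverse; mk↔ₛ′)
  open import Function.Properties.Inverse using (↔-refl; ↔-trans; ↔-sym)
  open import Relation.Binary using (tri<; tri≈; tri>)
  open import Relation.Binary.PropositionalEquality
    using (_≡_; _≢_; refl; sym; trans; cong; cong₂; subst; subst₂; module ≡-Reasoning)
  open import Relation.Nullary using (does; yes; no)
  open import Relation.Nullary.Decidable using (¬?; _×-dec_; dec-true; dec-false)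
  open import Algebra.Properties.Semiring.Sum ℕ.+-*-semiring public
    using (sum; sum-syntax; sum-cong-≗; ∑-distrib-+; *-distribˡ-sum; sum-replicate-zero)
  open +-*-Solver

  𝟙ℕ : Bool → ℕ
  𝟙ℕ true  = 1
  𝟙ℕ false = 0

  𝟙ℕ-≤1 : ∀ b → 𝟙ℕ b ≤ 1
  𝟙ℕ-≤1 true  = s≤s z≤n
  𝟙ℕ-≤1 false = z≤n

  δℕ : ∀ {m} → Fin m → Fin m → ℕ
  δℕ u x = 𝟙ℕ (does (x ≟ u))

  ∑-*-δℕ : ∀ {m} (f : Fin m → ℕ) u → ∑[ x < m ] (f x * δℕ u x) ≡ f u
  ∑-*-δℕ {suc m} f Fin.zero =
    trans (cong₂ _+_ (ℕ.*-identityʳ (f Fin.zero))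
                     (trans (sum-cong-≗ (λ x → ℕ.*-zeroʳ (f (Fin.suc x)))) (sum-replicate-zero m)))
          (ℕ.+-identityʳ _)
  ∑-*-δℕ {suc m} f (Fin.suc u) = cong₂ _+_ (ℕ.*-zeroʳ (f Fin.zero)) (∑-*-δℕ (λ x → f (Fin.suc x)) u)

  ∑-δℕ : ∀ {m} (u : Fin m) → ∑[ x < m ] δℕ u x ≡ 1
  ∑-δℕ u = trans (sum-cong-≗ (λ x → sym (ℕ.*-identityˡ (δℕ u x)))) (∑-*-δℕ (λ _ → 1) u)

  ∑-1 : ∀ m → ∑[ x < m ] 1 ≡ m
  ∑-1 zero    = refl
  ∑-1 (suc m) = cong suc (∑-1 m)

  ∑-mono-≤ : ∀ {m} {f g : Fin m → ℕ} → (∀ x → f x ≤ g x) → sum f ≤ sum g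
  ∑-mono-≤ {zero}  f≤g = z≤n
  ∑-mono-≤ {suc m} f≤g = ℕ.+-mono-≤ (f≤g Fin.zero) (∑-mono-≤ (λ x → f≤g (Fin.suc x)))

  term-≤-∑ : ∀ {m} (f : Fin m → ℕ) u → f u ≤ sum f
  term-≤-∑ f Fin.zero    = ℕ.m≤m+n _ _
  term-≤-∑ f (Fin.suc u) = ℕ.≤-trans (term-≤-∑ (λ x → f (Fin.suc x)) u) (ℕ.m≤n+m _ _)

  ∑-positive : ∀ {m} (f : Fin m → ℕ) → 1 ≤ sum f → Σ (Fin m) (λ u → 1 ≤ f u)
  ∑-positive {suc m} f 1≤∑f with f Fin.zero in f₀
  ... | suc _ = Fin.zero , subst (1 ≤_) (sym f₀) (s≤s z≤n)
  ... | zero  with ∑-positive (λ x → f (Fin.suc x)) 1≤∑f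
  ...   | u , 1≤fu = Fin.suc u , 1≤fu

  ∑-≤-pointwise-≡ : ∀ {m} {f g : Fin m → ℕ} → (∀ x → f x ≤ g x) → sum f ≡ sum g → ∀ x → f x ≡ g x
  ∑-≤-pointwise-≡ {suc m} {f} {g} f≤g ∑f≡∑g Fin.zero = ℕ.≤-antisym (f≤g Fin.zero)
    (ℕ.+-cancelʳ-≤ (sum (λ x → f (Fin.suc x))) _ _
      (subst (g Fin.zero + sum (λ x → f (Fin.suc x)) ≤_) (sym ∑f≡∑g)
        (ℕ.+-monoʳ-≤ (g Fin.zero) (∑-mono-≤ (λ x → f≤g (Fin.suc x))))))
  ∑-≤-pointwise-≡ {suc m} {f} {g} f≤g ∑f≡∑g (Fin.suc u) =
    ∑-≤-pointwise-≡ (λ x → f≤g (Fin.suc x))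
      (ℕ.≤-antisym (∑-mono-≤ (λ x → f≤g (Fin.suc x)))
        (ℕ.+-cancelˡ-≤ (f Fin.zero) _ _
          (subst (f Fin.zero + sum (λ x → g (Fin.suc x)) ≤_) (sym ∑f≡∑g)
            (ℕ.+-monoˡ-≤ (sum (λ x → g (Fin.suc x))) (f≤g Fin.zero))))) u

  module _ {m : ℕ} where

    count : (Fin m → Bool) → ℕ
    count P = ∑[ x < m ] 𝟙ℕ (P x)

    _⊆_ : (Fin m → Bool) → (Fin m → Bool) → Set
    P ⊆ Q = ∀ x → P x ≡ true → Q x ≡ true

    𝟙ℕ-mono : ∀ {a b} → (a ≡ true → b ≡ true) → 𝟙ℕ a ≤ 𝟙ℕ b
    𝟙ℕ-mono {false} a⇒b = z≤n
    𝟙ℕ-mono {true}  a⇒b rewrite a⇒b refl = s≤s z≤n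

    count-mono : ∀ {P Q} → P ⊆ Q → count P ≤ count Q
    count-mono P⊆Q = ∑-mono-≤ (λ x → 𝟙ℕ-mono (P⊆Q x))

    count-all : count (λ _ → true) ≡ m
    count-all = ∑-1 m

    count-≟ : ∀ v → count (λ x → does (x ≟ v)) ≡ 1
    count-≟ = ∑-δℕ

    count-complement : ∀ P → count P + count (λ x → not (P x)) ≡ m
    count-complement P = trans (sym (∑-distrib-+ (λ x → 𝟙ℕ (P x)) (λ x → 𝟙ℕ (not (P x)))))
                               (trans (sum-cong-≗ (λ x → one (P x))) (∑-1 m))
      where
      one : ∀ b → 𝟙ℕ b + 𝟙ℕ (not b) ≡ 1
      one true  = refl
      one false = refl

    count-≥1 : ∀ P {x} → P x ≡ true → 1 ≤ count P
    count-≥1 P {x} Px = subst (λ b → 𝟙ℕ b ≤ count P) Px (term-≤-∑ (λ y → 𝟙ℕ (P y)) x)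

    count-witness : ∀ P → 1 ≤ count P → Σ (Fin m) (λ x → P x ≡ true)
    count-witness P 1≤c with ∑-positive (λ y → 𝟙ℕ (P y)) 1≤c
    ... | x , 1≤𝟙Px with P x in Px
    ...   | true = x , Px

    count-strict-mono : ∀ {P Q v} → P ⊆ Q → P v ≡ false → Q v ≡ true → count P < count Q
    count-strict-mono {P} {Q} {v} P⊆Q Pv Qv =
      subst (_≤ count Q) (trans (∑-distrib-+ (λ x → 𝟙ℕ (P x)) (δℕ v)) (trans (cong (count P +_) (∑-δℕ v)) (ℕ.+-comm (count P) 1)))
            (∑-mono-≤ pointwise)
      where
      pointwise : ∀ x → 𝟙ℕ (P x) + δℕ v x ≤ 𝟙ℕ (Q x)
      pointwise x with x ≟ v
      ... | yes refl rewrite Pv | Qv = s≤s z≤n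
      ... | no  _    = ℕ.≤-trans (ℕ.≤-reflexive (ℕ.+-identityʳ _)) (𝟙ℕ-mono (P⊆Q x))

    count-⊆-≡ : ∀ {P Q} → P ⊆ Q → count P ≡ count Q → ∀ x → P x ≡ Q x
    count-⊆-≡ {P} {Q} P⊆Q c≡ x = 𝟙ℕ-injective (∑-≤-pointwise-≡ (λ y → 𝟙ℕ-mono (P⊆Q y)) c≡ x)
      where
      𝟙ℕ-injective : ∀ {a b} → 𝟙ℕ a ≡ 𝟙ℕ b → a ≡ b
      𝟙ℕ-injective {true}  {true}  _ = refl
      𝟙ℕ-injective {false} {false} _ = refl

    count-none : ∀ {P} → (∀ x → P x ≡ false) → count P ≡ 0
    count-none {P} P≡false = trans (sum-cong-≗ (λ x → cong 𝟙ℕ (P≡false x))) (sum-replicate-zero m)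

    insert : (Fin m → Bool) → Fin m → Fin m → Bool
    insert P v x = P x ∨ does (x ≟ v)

    count-insert : ∀ P {v} → P v ≡ false → count (insert P v) ≡ suc (count P)
    count-insert P {v} Pv = trans (sum-cong-≗ pointwise)
      (trans (∑-distrib-+ (λ x → 𝟙ℕ (P x)) (δℕ v)) (trans (cong (count P +_) (∑-δℕ v)) (ℕ.+-comm (count P) 1)))
      where
      pointwise : ∀ x → 𝟙ℕ (insert P v x) ≡ 𝟙ℕ (P x) + δℕ v x
      pointwise x with x ≟ v
      ... | yes refl rewrite Pv = refl
      ... | no  _    = trans (cong 𝟙ℕ (∨-identityʳ (P x))) (sym (ℕ.+-identityʳ _))

    insert-⊆ : ∀ {P Q v} → P ⊆ Q → Q v ≡ true → insert P v ⊆ Q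
    insert-⊆ {P} {Q} {v} P⊆Q Qv x with x ≟ v
    ... | yes refl = λ _ → Qv
    ... | no  _    = λ Px∨false → P⊆Q x (trans (sym (∨-identityʳ (P x))) Px∨false)

  n*[1+n]≤[2+n]*d⇒n≤d : ∀ n d → n * suc n ≤ suc (suc n) * d → n ≤ d
  n*[1+n]≤[2+n]*d⇒n≤d zero    d _     = z≤n
  n*[1+n]≤[2+n]*d⇒n≤d (suc k) d bound = ℕ.≮⇒≥ (λ d<n → ℕ.<⇒≱ (gap (ℕ.≤-pred d<n)) bound)
    where
    open ℕ.≤-Reasoning
    gap : d ≤ k → (3 + k) * d < (1 + k) * (2 + k)
    gap d≤k = begin-strict
      (3 + k) * d      ≤⟨ ℕ.*-monoʳ-≤ (3 + k) d≤k ⟩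
      (3 + k) * k      <⟨ ℕ.m<m+n _ (s≤s z≤n) ⟩
      (3 + k) * k + 2  ≡⟨ solve 1 (λ k → (con 3 :+ k) :* k :+ con 2 := (con 1 :+ k) :* (con 2 :+ k)) refl k ⟩
      (1 + k) * (2 + k) ∎

  n*[1+n]+q<[1+n]*d+n : ∀ n d q → n ≤ d → q < d → n * suc n + q < suc n * d + n
  n*[1+n]+q<[1+n]*d+n n d q n≤d q<d = begin-strict
    n * suc n + q   <⟨ ℕ.+-monoʳ-< (n * suc n) q<d ⟩
    n * suc n + d   ≡⟨ solve 2 (λ n d → n :* (con 1 :+ n) :+ d := n :* n :+ d :+ n) refl n d ⟩
    n * n + d + n   ≤⟨ ℕ.+-monoˡ-≤ n (ℕ.+-monoˡ-≤ d (ℕ.*-monoʳ-≤ n n≤d)) ⟩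
    n * d + d + n   ≡⟨ solve 2 (λ n d → n :* d :+ d :+ n := (con 1 :+ n) :* d :+ n) refl n d ⟩
    suc n * d + n   ∎
    where open ℕ.≤-Reasoning

  n*[1+d]≡n*[1+n]+q⇒d≤1+n : ∀ n d q → n * suc d ≡ n * suc n + q → q < d → d ≤ n + n → d ≤ suc n
  n*[1+d]≡n*[1+n]+q⇒d≤1+n zero          d q _ _   d≤0 = ℕ.≤-trans d≤0 z≤n
  n*[1+d]≡n*[1+n]+q⇒d≤1+n (suc zero)    d q _ _   d≤2 = d≤2
  n*[1+d]≡n*[1+n]+q⇒d≤1+n n@(suc (suc j)) d q eq q<d _ with d ℕ.≤? suc n
  ... | yes d≤1+n = d≤1+n
  ... | no  d≰1+n = ⊥-elim (ℕ.<⇒≱ q<d d≤q)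
    where
    open ℕ.≤-Reasoning
    x : ℕ
    x = proj₁ (ℕ.m≤n⇒∃[o]m+o≡n (ℕ.≰⇒> d≰1+n))
    d≡ : suc (suc n) + x ≡ d
    d≡ = proj₂ (ℕ.m≤n⇒∃[o]m+o≡n (ℕ.≰⇒> d≰1+n))
    q≡ : q ≡ n * (2 + x)
    q≡ = sym (ℕ.+-cancelˡ-≡ (n * suc n) _ _ (begin-equality
      n * suc n + n * (2 + x)      ≡⟨ solve 2 (λ n x → n :* (con 1 :+ n) :+ n :* (con 2 :+ x) := n :* (con 1 :+ (con 2 :+ n :+ x))) refl n x ⟩
      n * suc (suc (suc n) + x)    ≡⟨ cong (λ e → n * suc e) d≡ ⟩
      n * suc d                    ≡⟨ eq ⟩
      n * suc n + q                ∎))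
    d≤q : d ≤ q
    d≤q = begin
      d                                    ≡⟨ sym d≡ ⟩
      4 + j + x                            ≤⟨ ℕ.m≤m+n (4 + j + x) (j + x + j * x) ⟩
      4 + j + x + (j + x + j * x)          ≡⟨ solve 2 (λ j x → con 4 :+ j :+ x :+ (j :+ x :+ j :* x) := (con 2 :+ j) :* (con 2 :+ x)) refl j x ⟩
      n * (2 + x)                          ≡⟨ sym q≡ ⟩
      q                                    ∎

  [n+b]*n≡n*[1+n]+q⇒b×q≡0 : ∀ k b q → (suc k + 𝟙ℕ b) * suc k ≡ suc k * suc (suc k) + q → b ≡ true × q ≡ 0
  [n+b]*n≡n*[1+n]+q⇒b×q≡0 k true  q eq = refl , sym (ℕ.+-cancelˡ-≡ (suc k * suc (suc k)) 0 q
    (trans (solve 1 (λ k → (con 1 :+ k) :* (con 2 :+ k) :+ con 0 := ((con 1 :+ k) :+ con 1) :* (con 1 :+ k)) refl k) eq))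
  [n+b]*n≡n*[1+n]+q⇒b×q≡0 k false q eq = ⊥-elim (ℕ.m+1+n≢m (suc k * suc k) (sym (begin-equality
    suc k * suc k                    ≡⟨ solve 1 (λ k → (con 1 :+ k) :* (con 1 :+ k) := ((con 1 :+ k) :+ con 0) :* (con 1 :+ k)) refl k ⟩
    (suc k + 0) * suc k              ≡⟨ eq ⟩
    suc k * suc (suc k) + q          ≡⟨ solve 2 (λ k q → (con 1 :+ k) :* (con 2 :+ k) :+ q := (con 1 :+ k) :* (con 1 :+ k) :+ (con 1 :+ (k :+ q))) refl k q ⟩
    suc k * suc k + suc (k + q)      ∎)))
    where open ℕ.≤-Reasoning

  inA-↑ˡ : ∀ {a} b (i : Fin a) → inA a (i ↑ˡ b) ≡ true
  inA-↑ˡ b Fin.zero    = refl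
  inA-↑ˡ b (Fin.suc i) = inA-↑ˡ b i

  inA-↑ʳ : ∀ a {b} (j : Fin b) → inA a (a ↑ʳ j) ≡ false
  inA-↑ʳ zero    j = refl
  inA-↑ʳ (suc a) j = inA-↑ʳ a j

  isLeft : ∀ {A B : Set} → A ⊎ B → Bool
  isLeft (inj₁ _) = true
  isLeft (inj₂ _) = false

  module _ {m a : ℕ} {B : Set} (σ : Fin m ↔ (Fin a ⊎ B)) where
    private module σ = Inverse σ

    ⊎-liftˡ : Fin (suc m) ↔ (Fin (suc a) ⊎ B)
    ⊎-liftˡ = mk↔ₛ′ to from to∘from from∘to
      where
      to : Fin (suc m) → Fin (suc a) ⊎ B
      to Fin.zero    = inj₁ Fin.zero
      to (Fin.suc x) = map₁ Fin.suc (σ.to x)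
      from : Fin (suc a) ⊎ B → Fin (suc m)
      from (inj₁ Fin.zero)    = Fin.zero
      from (inj₁ (Fin.suc i)) = Fin.suc (σ.from (inj₁ i))
      from (inj₂ b)           = Fin.suc (σ.from (inj₂ b))
      from-suc : ∀ y → from (map₁ Fin.suc y) ≡ Fin.suc (σ.from y)
      from-suc (inj₁ _) = refl
      from-suc (inj₂ _) = refl
      to∘from : ∀ y → to (from y) ≡ y
      to∘from (inj₁ Fin.zero)    = refl
      to∘from (inj₁ (Fin.suc i)) = cong (map₁ Fin.suc) (σ.strictlyInverseˡ (inj₁ i))
      to∘from (inj₂ b)           = cong (map₁ Fin.suc) (σ.strictlyInverseˡ (inj₂ b))
      from∘to : ∀ x → from (to x) ≡ x
      from∘to Fin.zero    = refl
      from∘to (Fin.suc x) = trans (from-suc (σ.to x)) (cong Fin.suc (σ.strictlyInverseʳ x))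

  module _ {m b : ℕ} {A : Set} (σ : Fin m ↔ (A ⊎ Fin b)) where
    private module σ = Inverse σ

    ⊎-liftʳ : Fin (suc m) ↔ (A ⊎ Fin (suc b))
    ⊎-liftʳ = mk↔ₛ′ to from to∘from from∘to
      where
      to : Fin (suc m) → A ⊎ Fin (suc b)
      to Fin.zero    = inj₂ Fin.zero
      to (Fin.suc x) = map₂ Fin.suc (σ.to x)
      from : A ⊎ Fin (suc b) → Fin (suc m)
      from (inj₂ Fin.zero)    = Fin.zero
      from (inj₂ (Fin.suc j)) = Fin.suc (σ.from (inj₂ j))
      from (inj₁ a)           = Fin.suc (σ.from (inj₁ a))
      from-suc : ∀ y → from (map₂ Fin.suc y) ≡ Fin.suc (σ.from y)
      from-suc (inj₁ _) = refl
      from-suc (inj₂ _) = refl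
      to∘from : ∀ y → to (from y) ≡ y
      to∘from (inj₂ Fin.zero)    = refl
      to∘from (inj₂ (Fin.suc j)) = cong (map₂ Fin.suc) (σ.strictlyInverseˡ (inj₂ j))
      to∘from (inj₁ a)           = cong (map₂ Fin.suc) (σ.strictlyInverseˡ (inj₁ a))
      from∘to : ∀ x → from (to x) ≡ x
      from∘to Fin.zero    = refl
      from∘to (Fin.suc x) = trans (from-suc (σ.to x)) (cong Fin.suc (σ.strictlyInverseʳ x))

  isLeft-map₁ : ∀ {A A′ B : Set} (f : A → A′) (y : A ⊎ B) → isLeft (map₁ f y) ≡ isLeft y
  isLeft-map₁ f (inj₁ _) = refl
  isLeft-map₁ f (inj₂ _) = refl

  isLeft-map₂ : ∀ {A B B′ : Set} (f : B → B′) (y : A ⊎ B) → isLeft (map₂ f y) ≡ isLeft y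
  isLeft-map₂ f (inj₁ _) = refl
  isLeft-map₂ f (inj₂ _) = refl

  partition : ∀ {m} (C : Fin m → Bool) →
    Σ (Fin m ↔ (Fin (count C) ⊎ Fin (count (λ x → not (C x))))) λ σ → ∀ x → isLeft (Inverse.to σ x) ≡ C x
  partition {zero}  C = mk↔ₛ′ (λ ()) (λ { (inj₁ ()) ; (inj₂ ()) }) (λ { (inj₁ ()) ; (inj₂ ()) }) (λ ()) , λ ()
  partition {suc m} C with C Fin.zero in C₀ | partition (λ x → C (Fin.suc x))
  ... | true  | σ , σ-C = ⊎-liftˡ σ , λ { Fin.zero → sym C₀ ; (Fin.suc x) → trans (isLeft-map₁ Fin.suc _) (σ-C x) }
  ... | false | σ , σ-C = ⊎-liftʳ σ , λ { Fin.zero → sym C₀ ; (Fin.suc x) → trans (isLeft-map₂ Fin.suc _) (σ-C x) }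

  relabel : ∀ {m} (C : Fin m → Bool) →
    Σ (Fin m ↔ Fin (count C + count (λ x → not (C x)))) λ f → ∀ x → inA (count C) (Inverse.to f x) ≡ C x
  relabel C = ↔-trans σ (↔-sym +↔⊎) , λ x → trans (inA-join (Inverse.to σ x)) (σ-C x)
    where
    σ = proj₁ (partition C)
    σ-C = proj₂ (partition C)
    inA-join : ∀ y → inA (count C) (Inverse.from (+↔⊎ {count C}) y) ≡ isLeft y
    inA-join (inj₁ i) = inA-↑ˡ _ i
    inA-join (inj₂ j) = inA-↑ʳ (count C) j

  isomorphic-of-colouring : ∀ {m} (H : Graph m) (C : Fin m → Bool) {a b} →
    count C ≡ a → count (λ x → not (C x)) ≡ b → (∀ u v → adj H u v ≡ (C u xor C v)) → Isomorphic H (K a b)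
  isomorphic-of-colouring H C refl refl adj≡xor =
    f , λ u v → trans (adj≡xor u v) (cong₂ _xor_ (sym (f-C u)) (sym (f-C v)))
    where
    f = proj₁ (relabel C)
    f-C = proj₂ (relabel C)

  module _ {m : ℕ} (H : Graph m) where

    degree : Fin m → ℕ
    degree u = count (adj H u)

    farNeighbours : (Fin m → Fin m → Bool) → Fin m → Fin m → ℕ
    farNeighbours far u v = count (λ x → adj H u x ∧ far x v)

  true≢false : true ≢ false
  true≢false ()

  ∧-true-left : ∀ {a b} → a ∧ b ≡ true → a ≡ true
  ∧-true-left {true} _ = refl

  𝟙ℕ-∧ : ∀ a b → 𝟙ℕ (a ∧ b) ≡ 𝟙ℕ a * 𝟙ℕ b
  𝟙ℕ-∧ true  b = sym (ℕ.+-identityʳ (𝟙ℕ b))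
  𝟙ℕ-∧ false b = refl

  module _ {m : ℕ} (H : Graph m) (n : ℕ) (far : Fin m → Fin m → Bool) where

    -- In a graph with the resistance spectrum of K_{n,n+1}, n(n+1)/2 times the resistance distance.
    resistanceLevel : Fin m → Fin m → ℕ
    resistanceLevel u v = if does (u ≟ v) then 0 else n + 𝟙ℕ (far u v)

    private
      ρ = resistanceLevel
      A : Fin m → Fin m → ℕ
      A u x = 𝟙ℕ (adj H u x)

    ρ-off : ∀ {u v} → u ≢ v → ρ u v ≡ n + 𝟙ℕ (far u v)
    ρ-off {u} {v} u≢v rewrite dec-false (u ≟ v) u≢v = refl

    farNeighbours-as-∑ : ∀ u w → farNeighbours H far u w ≡ ∑[ x < m ] (A u x * 𝟙ℕ (far x w))
    farNeighbours-as-∑ u w = sum-cong-≗ (λ x → 𝟙ℕ-∧ (adj H u x) (far x w))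

    ∑-level-from : (∀ u v → far u v ≡ far v u) → ∀ {u v} → u ≢ v →
      ∑[ x < m ] (A u x * (ρ u v + ρ u x)) ≡ (n + 𝟙ℕ (far u v)) * degree H u + (n * degree H u + farNeighbours H far u u)
    ∑-level-from far-sym {u} {v} u≢v = begin
        ∑[ x < m ] (A u x * (ρ u v + ρ u x))
          ≡⟨ sum-cong-≗ pointwise ⟩
        ∑[ x < m ] (ρ u v * A u x + (n * A u x + A u x * 𝟙ℕ (far x u)))
          ≡⟨ trans (∑-distrib-+ (λ x → ρ u v * A u x) (λ x → n * A u x + A u x * 𝟙ℕ (far x u)))
               (cong₂ _+_ (sym (*-distribˡ-sum (ρ u v) (A u)))
                 (trans (∑-distrib-+ (λ x → n * A u x) (λ x → A u x * 𝟙ℕ (far x u)))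
                   (cong₂ _+_ (sym (*-distribˡ-sum n (A u))) (sym (farNeighbours-as-∑ u u))))) ⟩
        ρ u v * degree H u + (n * degree H u + farNeighbours H far u u)
          ≡⟨ cong (λ r → r * degree H u + (n * degree H u + farNeighbours H far u u)) (ρ-off u≢v) ⟩
        (n + 𝟙ℕ (far u v)) * degree H u + (n * degree H u + farNeighbours H far u u) ∎
      where
      open ≡-Reasoning
      pointwise : ∀ x → A u x * (ρ u v + ρ u x) ≡ ρ u v * A u x + (n * A u x + A u x * 𝟙ℕ (far x u))
      pointwise x with adj H u x in ux
      ... | false = solve 3 (λ r n s → con 0 :* (r :+ s) := r :* con 0 :+ (n :* con 0 :+ con 0)) refl (ρ u v) n (ρ u x)
      ... | true  = begin
        1 * (ρ u v + ρ u x)                     ≡⟨ cong (λ t → 1 * (ρ u v + t)) (ρ-off u≢x) ⟩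
        1 * (ρ u v + (n + 𝟙ℕ (far u x)))        ≡⟨ cong (λ b → 1 * (ρ u v + (n + 𝟙ℕ b))) (far-sym u x) ⟩
        1 * (ρ u v + (n + 𝟙ℕ (far x u)))        ≡⟨ solve 3 (λ r n b → con 1 :* (r :+ (n :+ b)) := r :* con 1 :+ (n :* con 1 :+ con 1 :* b))
                                                      refl (ρ u v) n (𝟙ℕ (far x u)) ⟩
        ρ u v * 1 + (n * 1 + 1 * 𝟙ℕ (far x u))  ∎
        where
        u≢x : u ≢ x
        u≢x refl = true≢false (trans (sym ux) (irefl H u))

    ∑-level-to : (∀ u → far u u ≡ false) → ∀ u v →
      ∑[ x < m ] (A u x * ρ x v) + n * A u v ≡ n * degree H u + farNeighbours H far u v
    ∑-level-to far-irrefl u v = begin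
        ∑[ x < m ] (A u x * ρ x v) + n * A u v
          ≡⟨ cong (λ t → ∑[ x < m ] (A u x * ρ x v) + n * t) (sym (∑-*-δℕ (A u) v)) ⟩
        ∑[ x < m ] (A u x * ρ x v) + n * ∑[ x < m ] (A u x * δℕ v x)
          ≡⟨ cong (∑[ x < m ] (A u x * ρ x v) +_) (*-distribˡ-sum n (λ x → A u x * δℕ v x)) ⟩
        ∑[ x < m ] (A u x * ρ x v) + ∑[ x < m ] (n * (A u x * δℕ v x))
          ≡⟨ sym (∑-distrib-+ (λ x → A u x * ρ x v) (λ x → n * (A u x * δℕ v x))) ⟩
        ∑[ x < m ] (A u x * ρ x v + n * (A u x * δℕ v x))
          ≡⟨ sum-cong-≗ pointwise ⟩
        ∑[ x < m ] (n * A u x + A u x * 𝟙ℕ (far x v))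
          ≡⟨ trans (∑-distrib-+ (λ x → n * A u x) (λ x → A u x * 𝟙ℕ (far x v)))
               (cong₂ _+_ (sym (*-distribˡ-sum n (A u))) (sym (farNeighbours-as-∑ u v))) ⟩
        n * degree H u + farNeighbours H far u v ∎
      where
      open ≡-Reasoning
      pointwise : ∀ x → A u x * ρ x v + n * (A u x * δℕ v x) ≡ n * A u x + A u x * 𝟙ℕ (far x v)
      pointwise x with x ≟ v
      ... | yes refl = begin
        A u x * 0 + n * (A u x * 1)       ≡⟨ solve 2 (λ a n → a :* con 0 :+ n :* (a :* con 1) := n :* a :+ a :* con 0) refl (A u x) n ⟩
        n * A u x + A u x * 0             ≡⟨ cong (λ b → n * A u x + A u x * 𝟙ℕ b) (sym (far-irrefl x)) ⟩
        n * A u x + A u x * 𝟙ℕ (far x x)  ∎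
      ... | no _ = solve 3 (λ a n b → a :* (n :+ b) :+ n :* (a :* con 0) := n :* a :+ a :* b) refl (A u x) n (𝟙ℕ (far x v))

    degreeEquation-of-localIdentity : (∀ u v → far u v ≡ far v u) → (∀ u → far u u ≡ false) → ∀ {u v} → u ≢ v →
      ∑[ x < m ] (A u x * (ρ u v + ρ u x)) ≡ n * suc n + ∑[ x < m ] (A u x * ρ x v) →
      (n + 𝟙ℕ (far u v)) * degree H u + farNeighbours H far u u + n * A u v ≡ n * suc n + farNeighbours H far u v
    degreeEquation-of-localIdentity far-sym far-irrefl {u} {v} u≢v local = ℕ.+-cancelˡ-≡ (n * d) _ _ (begin
        n * d + ((n + f) * d + p + n * A u v)              ≡⟨ solve 5 (λ n f d p a → n :* d :+ ((n :+ f) :* d :+ p :+ n :* a) := (n :+ f) :* d :+ (n :* d :+ p) :+ n :* a)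
                                                               refl n f d p (A u v) ⟩
        (n + f) * d + (n * d + p) + n * A u v              ≡⟨ cong (_+ n * A u v) (sym (∑-level-from far-sym u≢v)) ⟩
        ∑[ x < m ] (A u x * (ρ u v + ρ u x)) + n * A u v   ≡⟨ cong (_+ n * A u v) local ⟩
        n * suc n + S + n * A u v                          ≡⟨ ℕ.+-assoc (n * suc n) S (n * A u v) ⟩
        n * suc n + (S + n * A u v)                        ≡⟨ cong (n * suc n +_) (∑-level-to far-irrefl u v) ⟩
        n * suc n + (n * d + q)                            ≡⟨ solve 3 (λ c e q → c :+ (e :+ q) := e :+ (c :+ q)) refl (n * suc n) (n * d) q ⟩
        n * d + (n * suc n + q)                            ∎)
      where
      open ≡-Reasoning
      d = degree H u
      f = 𝟙ℕ (far u v)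
      p = farNeighbours H far u u
      q = farNeighbours H far u v
      S = ∑[ x < m ] (A u x * ρ x v)

  -- In the application, far u v says that R(u,v) is the larger of the two resistances of K_{n,n+1}.
  module DegreeEquation
    (k m : ℕ) (H : Graph m) (m≡ : m ≡ suc k + suc (suc k))
    (far : Fin m → Fin m → Bool) (far-sym : ∀ u v → far u v ≡ far v u) (far-irrefl : ∀ u → far u u ≡ false)
    (degree-equation : ∀ u v → u ≢ v →
       (suc k + 𝟙ℕ (far u v)) * degree H u + farNeighbours H far u u + suc k * 𝟙ℕ (adj H u v)
         ≡ suc k * suc (suc k) + farNeighbours H far u v)
    where

    n : ℕ
    n = suc k

    private
      deg : Fin m → ℕ
      deg = degree H
      far# : Fin m → Fin m → ℕ
      far# = farNeighbours H far

    adjacent⇒≢ : ∀ {u v} → adj H u v ≡ true → u ≢ v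
    adjacent⇒≢ {u} uv refl = true≢false (trans (sym uv) (irefl H u))

    adjacent-sym : ∀ {u v} → adj H u v ≡ true → adj H v u ≡ true
    adjacent-sym {u} {v} uv = trans (Graph.sym H v u) uv

    degree≤n+n : ∀ u → deg u ≤ n + n
    degree≤n+n u = ℕ.≤-pred (subst (deg u <_) (trans count-all (trans m≡ (ℕ.+-suc n n)))
                     (count-strict-mono {P = adj H u} {Q = λ _ → true} (λ _ _ → refl) (irefl H u) refl))

    farNeighbours≤degree : ∀ u v → far# u v ≤ deg u
    farNeighbours≤degree u v = count-mono {P = λ x → adj H u x ∧ far x v} {Q = adj H u} (λ x → ∧-true-left)

    farNeighbours<degree : ∀ {u v} → adj H u v ≡ true → far# u v < deg u
    farNeighbours<degree {u} {v} uv =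
      count-strict-mono {P = λ x → adj H u x ∧ far x v} {Q = adj H u} (λ x → ∧-true-left) (trans (cong (_∧ far v v) uv) (far-irrefl v)) uv

    nonNeighbour-or-dense : ∀ u → (Σ (Fin m) λ v → u ≢ v × adj H u v ≡ false) ⊎ (n + n ≤ deg u)
    nonNeighbour-or-dense u with any? (λ v → ¬? (u ≟ v) ×-dec (adj H u v ≟ᵇ false))
    ... | yes (v , u≢v , uv) = inj₁ (v , u≢v , uv)
    ... | no  ∄v = inj₂ (ℕ.+-cancelˡ-≤ 1 _ _ (begin
        suc (n + n)                         ≡⟨ sym (trans m≡ (ℕ.+-suc n n)) ⟩
        m                                   ≡⟨ sym (count-complement (adj H u)) ⟩
        deg u + count (λ x → not (adj H u x)) ≤⟨ ℕ.+-monoʳ-≤ (deg u) (ℕ.≤-trans (count-mono {Q = λ x → does (x ≟ u)} nonNeighbour⇒u) (ℕ.≤-reflexive (count-≟ u))) ⟩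
        deg u + 1                           ≡⟨ ℕ.+-comm (deg u) 1 ⟩
        suc (deg u)                         ∎))
      where
      open ℕ.≤-Reasoning
      nonNeighbour⇒u : (λ x → not (adj H u x)) ⊆ (λ x → does (x ≟ u))
      nonNeighbour⇒u x ¬ux with x ≟ u
      ... | yes _   = refl
      ... | no  x≢u = ⊥-elim (∄v (x , (λ u≡x → x≢u (sym u≡x)) , trans (sym (not-involutive _)) (cong not ¬ux)))

    n≤degree : ∀ u → n ≤ deg u
    n≤degree u with nonNeighbour-or-dense u
    ... | inj₂ n+n≤d = ℕ.≤-trans (ℕ.m≤m+n n n) n+n≤d
    ... | inj₁ (v , u≢v , uv) = n*[1+n]≤[2+n]*d⇒n≤d n (deg u) (begin
        n * suc n                                          ≤⟨ ℕ.m≤m+n (n * suc n) (far# u v) ⟩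
        n * suc n + far# u v                               ≡⟨ sym (degree-equation u v u≢v) ⟩
        (n + 𝟙ℕ (far u v)) * deg u + far# u u + n * 𝟙ℕ (adj H u v)
                                                           ≡⟨ cong (λ a → (n + 𝟙ℕ (far u v)) * deg u + far# u u + n * 𝟙ℕ a) uv ⟩
        (n + 𝟙ℕ (far u v)) * deg u + far# u u + n * 0      ≤⟨ ℕ.+-monoˡ-≤ (n * 0) (ℕ.+-mono-≤
                                                                (ℕ.*-monoˡ-≤ (deg u) (ℕ.+-monoʳ-≤ n (𝟙ℕ-≤1 (far u v))))
                                                                (farNeighbours≤degree u u)) ⟩
        (n + 1) * deg u + deg u + n * 0                    ≡⟨ solve 2 (λ n d → (n :+ con 1) :* d :+ d :+ n :* con 0 := (con 2 :+ n) :* d) refl n (deg u) ⟩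
        suc (suc n) * deg u                                ∎)
      where open ℕ.≤-Reasoning

    adjacent⇒near : ∀ {u v} → adj H u v ≡ true → far u v ≡ false
    adjacent⇒near {u} {v} uv with far u v in uv-far
    ... | false = refl
    ... | true  = ⊥-elim (ℕ.<-irrefl refl (begin-strict
        n * suc n + far# u v                                    <⟨ n*[1+n]+q<[1+n]*d+n n (deg u) (far# u v) (n≤degree u) (farNeighbours<degree uv) ⟩
        suc n * deg u + n                                       ≤⟨ ℕ.+-monoˡ-≤ n (ℕ.m≤m+n (suc n * deg u) (far# u u)) ⟩
        suc n * deg u + far# u u + n                            ≡⟨ solve 3 (λ n d p → (con 1 :+ n) :* d :+ p :+ n := (n :+ con 1) :* d :+ p :+ n :* con 1) refl n (deg u) (far# u u) ⟩
        (n + 1) * deg u + far# u u + n * 1                      ≡⟨ cong₂ (λ b a → (n + 𝟙ℕ b) * deg u + far# u u + n * 𝟙ℕ a) (sym uv-far) (sym uv) ⟩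
        (n + 𝟙ℕ (far u v)) * deg u + far# u u + n * 𝟙ℕ (adj H u v) ≡⟨ degree-equation u v (adjacent⇒≢ uv) ⟩
        n * suc n + far# u v                                    ∎))
      where open ℕ.≤-Reasoning

    farNeighbours-self : ∀ u → far# u u ≡ 0
    farNeighbours-self u = count-none near
      where
      near : ∀ x → (adj H u x ∧ far x u) ≡ false
      near x with adj H u x in ux
      ... | false = refl
      ... | true  = trans (far-sym x u) (adjacent⇒near ux)

    adjacent-equation : ∀ {u v} → adj H u v ≡ true → n * suc (deg u) ≡ n * suc n + far# u v
    adjacent-equation {u} {v} uv = begin
        n * suc (deg u)                                          ≡⟨ solve 2 (λ n d → n :* (con 1 :+ d) := (n :+ con 0) :* d :+ con 0 :+ n :* con 1) refl n (deg u) ⟩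
        (n + 𝟙ℕ false) * deg u + 0 + n * 𝟙ℕ true                 ≡⟨ cong₂ (λ b a → (n + 𝟙ℕ b) * deg u + 0 + n * 𝟙ℕ a) (sym (adjacent⇒near uv)) (sym uv) ⟩
        (n + 𝟙ℕ (far u v)) * deg u + 0 + n * 𝟙ℕ (adj H u v)      ≡⟨ cong (λ p → (n + 𝟙ℕ (far u v)) * deg u + p + n * 𝟙ℕ (adj H u v)) (sym (farNeighbours-self u)) ⟩
        (n + 𝟙ℕ (far u v)) * deg u + far# u u + n * 𝟙ℕ (adj H u v) ≡⟨ degree-equation u v (adjacent⇒≢ uv) ⟩
        n * suc n + far# u v                                     ∎
      where open ≡-Reasoning

    nonadjacent-equation : ∀ {u v} → u ≢ v → adj H u v ≡ false →
                           (n + 𝟙ℕ (far u v)) * deg u ≡ n * suc n + far# u v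
    nonadjacent-equation {u} {v} u≢v uv = begin
        (n + 𝟙ℕ (far u v)) * deg u                               ≡⟨ solve 3 (λ r d n → r :* d := r :* d :+ con 0 :+ n :* con 0) refl (n + 𝟙ℕ (far u v)) (deg u) n ⟩
        (n + 𝟙ℕ (far u v)) * deg u + 0 + n * 𝟙ℕ false             ≡⟨ cong₂ (λ p a → (n + 𝟙ℕ (far u v)) * deg u + p + n * 𝟙ℕ a) (sym (farNeighbours-self u)) (sym uv) ⟩
        (n + 𝟙ℕ (far u v)) * deg u + far# u u + n * 𝟙ℕ (adj H u v) ≡⟨ degree-equation u v u≢v ⟩
        n * suc n + far# u v                                     ∎
      where open ≡-Reasoning

    neighbour : ∀ u → Σ (Fin m) λ v → adj H u v ≡ true
    neighbour u = count-witness (adj H u) (ℕ.≤-trans (s≤s z≤n) (n≤degree u))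

    degree≤suc-n : ∀ u → deg u ≤ suc n
    degree≤suc-n u = let v , uv = neighbour u in
      n*[1+d]≡n*[1+n]+q⇒d≤1+n n (deg u) (far# u v) (adjacent-equation uv) (farNeighbours<degree uv) (degree≤n+n u)

    degree-n⊎suc-n : ∀ u → deg u ≡ n ⊎ deg u ≡ suc n
    degree-n⊎suc-n u with ℕ.m≤n⇒m<n∨m≡n (degree≤suc-n u)
    ... | inj₁ d<1+n = inj₁ (ℕ.≤-antisym (ℕ.≤-pred d<1+n) (n≤degree u))
    ... | inj₂ d≡1+n = inj₂ d≡1+n

    degree-n-nonadjacent⇒far : ∀ {u v} → deg u ≡ n → u ≢ v → adj H u v ≡ false → far u v ≡ true × far# u v ≡ 0
    degree-n-nonadjacent⇒far {u} {v} du u≢v uv =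
      [n+b]*n≡n*[1+n]+q⇒b×q≡0 k (far u v) (far# u v) (subst (λ d → (n + 𝟙ℕ (far u v)) * d ≡ n * suc n + far# u v) du (nonadjacent-equation u≢v uv))

    degree-n⇒farNeighbours≡0 : ∀ {u v} → deg u ≡ n → u ≢ v → far# u v ≡ 0
    degree-n⇒farNeighbours≡0 {u} {v} du u≢v with adj H u v in uv
    ... | false = proj₂ (degree-n-nonadjacent⇒far du u≢v uv)
    ... | true  = sym (ℕ.+-cancelˡ-≡ (n * suc n) 0 (far# u v)
                    (trans (ℕ.+-identityʳ (n * suc n)) (subst (λ d → n * suc d ≡ n * suc n + far# u v) du (adjacent-equation uv))))

    degree-suc-n-adjacent⇒farNeighbours≡n : ∀ {u v} → deg u ≡ suc n → adj H u v ≡ true → far# u v ≡ n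
    degree-suc-n-adjacent⇒farNeighbours≡n {u} {v} du uv = sym (ℕ.+-cancelˡ-≡ (n * suc n) n (far# u v) (begin
        n * suc n + n        ≡⟨ solve 1 (λ n → n :* (con 1 :+ n) :+ n := n :* (con 2 :+ n)) refl n ⟩
        n * suc (suc n)      ≡⟨ subst (λ d → n * suc d ≡ n * suc n + far# u v) du (adjacent-equation uv) ⟩
        n * suc n + far# u v ∎))
      where open ≡-Reasoning

    degree-suc-n-far⇒farNeighbours≡suc-n : ∀ {u v} → deg u ≡ suc n → u ≢ v → adj H u v ≡ false → far u v ≡ true → far# u v ≡ suc n
    degree-suc-n-far⇒farNeighbours≡suc-n {u} {v} du u≢v uv uv-far = sym (ℕ.+-cancelˡ-≡ (n * suc n) (suc n) (far# u v) (begin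
        n * suc n + suc n            ≡⟨ solve 1 (λ n → n :* (con 1 :+ n) :+ (con 1 :+ n) := (n :+ con 1) :* (con 1 :+ n)) refl n ⟩
        (n + 𝟙ℕ true) * suc n        ≡⟨ cong₂ (λ b d → (n + 𝟙ℕ b) * d) (sym uv-far) (sym du) ⟩
        (n + 𝟙ℕ (far u v)) * deg u   ≡⟨ nonadjacent-equation u≢v uv ⟩
        n * suc n + far# u v         ∎))
      where open ≡-Reasoning

    -- Otherwise u, v and the n+1 neighbours of u (far from v, hence not adjacent to it)
    -- are n+3 non-neighbours of v, leaving v fewer than n neighbours.
    degree-suc-n⇒near : ∀ {u} v → deg u ≡ suc n → far u v ≡ false
    degree-suc-n⇒near {u} v du with far u v in uv-far
    ... | false = refl
    ... | true  = ⊥-elim (ℕ.m+1+n≰m m (begin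
        m + 2                               ≡⟨ cong (_+ 2) m≡ ⟩
        n + suc n + 2                       ≡⟨ solve 1 (λ n → n :+ (con 1 :+ n) :+ con 2 := n :+ (con 3 :+ n)) refl n ⟩
        n + suc (suc (suc n))               ≡⟨ cong (λ d → n + suc (suc d)) (sym du) ⟩
        n + suc (suc (deg u))               ≤⟨ ℕ.+-mono-≤ (n≤degree v) (ℕ.≤-reflexive (sym count-S)) ⟩
        deg v + count S                     ≤⟨ ℕ.+-monoʳ-≤ (deg v) (count-mono {P = S} {Q = λ x → not (adj H v x)} S⊆nonNeighbours) ⟩
        deg v + count (λ x → not (adj H v x)) ≡⟨ count-complement (adj H v) ⟩
        m                                   ∎))
      where
      open ℕ.≤-Reasoning
      u≢v : u ≢ v
      u≢v refl = true≢false (trans (sym uv-far) (far-irrefl u))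
      uv : adj H u v ≡ false
      uv with adj H u v in uv
      ... | false = refl
      ... | true  = ⊥-elim (true≢false (trans (sym uv-far) (adjacent⇒near uv)))
      neighbours-far : ∀ x → (adj H u x ∧ far x v) ≡ adj H u x
      neighbours-far = count-⊆-≡ {P = λ x → adj H u x ∧ far x v} {Q = adj H u} (λ x → ∧-true-left)
                         (trans (degree-suc-n-far⇒farNeighbours≡suc-n du u≢v uv uv-far) (sym du))
      neighbours⊆nonNeighbours : adj H u ⊆ (λ x → not (adj H v x))
      neighbours⊆nonNeighbours x ux with adj H v x in vx
      ... | false = refl
      ... | true  = ⊥-elim (true≢false (trans x-far-v (trans (far-sym x v) (adjacent⇒near vx))))
        where
        x-far-v : true ≡ far x v
        x-far-v = trans (sym ux) (trans (sym (neighbours-far x)) (cong (_∧ far x v) ux))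
      S : Fin m → Bool
      S = insert (insert (adj H u) u) v
      S⊆nonNeighbours : S ⊆ (λ x → not (adj H v x))
      S⊆nonNeighbours = insert-⊆ (insert-⊆ neighbours⊆nonNeighbours (cong not (trans (Graph.sym H v u) uv)))
                                 (cong not (irefl H v))
      count-S : count S ≡ suc (suc (deg u))
      count-S = trans (count-insert (insert (adj H u) u) (cong₂ _∨_ uv (dec-false (v ≟ u) (u≢v ∘ sym))))
                      (cong suc (count-insert (adj H u) (irefl H u)))

    -- x has a non-neighbour w, which is far from x; so x is a neighbour of u far from w ≠ u,
    -- whereas no neighbour of a vertex u of degree n is far from a vertex other than u.
    degree-n-independent : ∀ {u x} → deg u ≡ n → deg x ≡ n → adj H u x ≡ true → ⊥
    degree-n-independent {u} {x} du dx ux with nonNeighbour-or-dense x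
    ... | inj₂ n+n≤dx = ℕ.m+1+n≰m n (subst (n + n ≤_) dx n+n≤dx)
    ... | inj₁ (w , x≢w , xw) = ℕ.n≮0 (subst (1 ≤_) (degree-n⇒farNeighbours≡0 du u≢w)
                                  (count-≥1 (λ y → adj H u y ∧ far y w) (cong₂ _∧_ ux x-far-w)))
      where
      x-far-w : far x w ≡ true
      x-far-w = proj₁ (degree-n-nonadjacent⇒far dx x≢w xw)
      u≢w : u ≢ w
      u≢w refl = true≢false (trans (sym (adjacent-sym ux)) xw)

    degree-suc-n-independent : ∀ {u x} → deg u ≡ suc n → deg x ≡ suc n → adj H u x ≡ true → ⊥
    degree-suc-n-independent {u} {x} du dx ux = ℕ.1+n≢0 (trans (sym (degree-suc-n-adjacent⇒farNeighbours≡n du ux)) (count-none near-x))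
      where
      near-x : ∀ y → (adj H u y ∧ far y x) ≡ false
      near-x y = trans (cong (adj H u y ∧_) (trans (far-sym y x) (degree-suc-n⇒near y dx))) (∧-zeroʳ (adj H u y))

    colour : Fin m → Bool
    colour u = does (deg u ℕ.≟ suc n)

    colour-of-degree : ∀ u → (deg u ≡ n × colour u ≡ false) ⊎ (deg u ≡ suc n × colour u ≡ true)
    colour-of-degree u with degree-n⊎suc-n u
    ... | inj₁ du = inj₁ (du , dec-false (deg u ℕ.≟ suc n) (λ d≡ → ℕ.1+n≢n (trans (sym d≡) du)))
    ... | inj₂ du = inj₂ (du , dec-true (deg u ℕ.≟ suc n) du)

    neighbours-opposite : ∀ u → adj H u ⊆ (λ y → colour u xor colour y)
    neighbours-opposite u y uy with colour-of-degree u | colour-of-degree y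
    ... | inj₁ (du , cu) | inj₁ (dy , cy) = ⊥-elim (degree-n-independent du dy uy)
    ... | inj₁ (du , cu) | inj₂ (dy , cy) = cong₂ _xor_ cu cy
    ... | inj₂ (du , cu) | inj₁ (dy , cy) = cong₂ _xor_ cu cy
    ... | inj₂ (du , cu) | inj₂ (dy , cy) = ⊥-elim (degree-suc-n-independent du dy uy)

    colourClassSizes : count colour ≡ n × count (λ y → not (colour y)) ≡ suc n
    colourClassSizes = #T≡n , ℕ.+-cancelˡ-≡ n _ _ (trans (cong (_+ #F) (sym #T≡n)) (trans (count-complement colour) m≡))
      where
      #T #F : ℕ
      #T = count colour
      #F = count (λ y → not (colour y))
      z : Fin m
      z = subst Fin (sym m≡) Fin.zero
      y = proj₁ (neighbour z)
      class-bound : ∀ u → deg u ≤ count (λ y → colour u xor colour y)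
      class-bound u = count-mono {Q = λ y → colour u xor colour y} (neighbours-opposite u)
      n≤#T : ∀ {u} → deg u ≡ n → colour u ≡ false → n ≤ #T
      n≤#T {u} du cu = subst₂ _≤_ du (cong (λ c → count (λ y → c xor colour y)) cu) (class-bound u)
      1+n≤#F : ∀ {u} → deg u ≡ suc n → colour u ≡ true → suc n ≤ #F
      1+n≤#F {u} du cu = subst₂ _≤_ du (cong (λ c → count (λ y → c xor colour y)) cu) (class-bound u)
      bounds : n ≤ #T × suc n ≤ #F
      bounds = both (colour-of-degree z) (colour-of-degree y)
        where
        zy = proj₂ (neighbour z)
        both : (deg z ≡ n × colour z ≡ false) ⊎ (deg z ≡ suc n × colour z ≡ true) →
               (deg y ≡ n × colour y ≡ false) ⊎ (deg y ≡ suc n × colour y ≡ true) → n ≤ #T × suc n ≤ #F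
        both (inj₁ (dz , cz)) (inj₂ (dy , cy)) = n≤#T dz cz , 1+n≤#F dy cy
        both (inj₂ (dz , cz)) (inj₁ (dy , cy)) = n≤#T dy cy , 1+n≤#F dz cz
        both (inj₁ (dz , _))  (inj₁ (dy , _))  = ⊥-elim (degree-n-independent dz dy zy)
        both (inj₂ (dz , _))  (inj₂ (dy , _))  = ⊥-elim (degree-suc-n-independent dz dy zy)
      #T≡n : #T ≡ n
      #T≡n = ℕ.≤-antisym (ℕ.+-cancelʳ-≤ #F #T n (begin
          #T + #F   ≡⟨ trans (count-complement colour) m≡ ⟩
          n + suc n ≤⟨ ℕ.+-monoʳ-≤ n (proj₂ bounds) ⟩
          n + #F    ∎)) (proj₁ bounds)
        where open ℕ.≤-Reasoning

    adjacency-by-colour : ∀ u v → adj H u v ≡ (colour u xor colour v)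
    adjacency-by-colour u = count-⊆-≡ (neighbours-opposite u) (class-size (colour-of-degree u))
      where
      class-size : (deg u ≡ n × colour u ≡ false) ⊎ (deg u ≡ suc n × colour u ≡ true) →
                   deg u ≡ count (λ y → colour u xor colour y)
      class-size (inj₁ (du , cu)) = trans du (trans (sym (proj₁ colourClassSizes))
                                      (cong (λ c → count (λ y → c xor colour y)) (sym cu)))
      class-size (inj₂ (du , cu)) = trans du (trans (sym (proj₂ colourClassSizes))
                                      (cong (λ c → count (λ y → c xor colour y)) (sym cu)))

    isomorphic : Isomorphic H (K n (suc n))
    isomorphic = isomorphic-of-colouring H colour (proj₁ colourClassSizes) (proj₂ colourClassSizes) adjacency-by-colour

  pairs : ℕ → ℕ
  pairs zero    = 0
  pairs (suc m) = m + pairs m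

  Pair-suc↔ : ∀ m → Pair (suc m) ↔ (Fin m ⊎ Pair m)
  Pair-suc↔ m = mk↔ₛ′ to from to∘from from∘to
    where
    to : Pair (suc m) → Fin m ⊎ Pair m
    to ((Fin.zero  , Fin.suc j) , _)       = inj₁ j
    to ((Fin.suc i , Fin.suc j) , s≤s i<j) = inj₂ ((i , j) , i<j)
    from : Fin m ⊎ Pair m → Pair (suc m)
    from (inj₁ j)                = (Fin.zero , Fin.suc j) , s≤s z≤n
    from (inj₂ ((i , j) , i<j))  = (Fin.suc i , Fin.suc j) , s≤s i<j
    to∘from : ∀ y → to (from y) ≡ y
    to∘from (inj₁ _) = refl
    to∘from (inj₂ _) = refl
    from∘to : ∀ p → from (to p) ≡ p
    from∘to ((Fin.zero  , Fin.suc j) , s≤s z≤n) = refl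
    from∘to ((Fin.suc i , Fin.suc j) , s≤s i<j) = refl

  Pair↔Fin-pairs : ∀ m → Pair m ↔ Fin (pairs m)
  Pair↔Fin-pairs zero    = mk↔ₛ′ (λ { ((() , _) , _) }) (λ ()) (λ ()) (λ { ((() , _) , _) })
  Pair↔Fin-pairs (suc m) = ↔-trans (Pair-suc↔ m) (↔-trans (↔-refl ⊎-↔ Pair↔Fin-pairs m) (↔-sym +↔⊎))

  pairs-mono : ∀ {a b} → a ≤ b → pairs a ≤ pairs b
  pairs-mono {a} {zero}  z≤n = z≤n
  pairs-mono {a} {suc b} a≤1+b with ℕ.m≤n⇒m<n∨m≡n a≤1+b
  ... | inj₁ (s≤s a≤b) = ℕ.≤-trans (pairs-mono a≤b) (ℕ.m≤n+m (pairs b) b)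
  ... | inj₂ refl      = ℕ.≤-refl

  pairs-< : ∀ {a c} → 1 ≤ c → a ≤ c → pairs a < pairs (suc c)
  pairs-< {a} {suc c} _ a≤c = ℕ.≤-trans (s≤s (pairs-mono a≤c)) (s≤s (ℕ.m≤n+m (pairs (suc c)) c))

  pairs-injective : ∀ {a b} → 2 ≤ b → pairs a ≡ pairs b → a ≡ b
  pairs-injective {a} {b} 2≤b eq with ℕ.<-cmp a b
  ... | tri≈ _ a≡b _ = a≡b
  ... | tri< a<b _ _ = ⊥-elim (ℕ.<-irrefl eq (below a<b))
    where
    below : a < b → pairs a < pairs b
    below (s≤s a≤c) = pairs-< (ℕ.≤-pred 2≤b) a≤c
  ... | tri> _ _ b<a = ⊥-elim (ℕ.<-irrefl (sym eq) (above b<a))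
    where
    above : b < a → pairs b < pairs a
    above (s≤s b≤c) = pairs-< (ℕ.≤-trans (s≤s z≤n) (ℕ.≤-trans 2≤b b≤c)) b≤c

  vertexCount : ∀ {m M} → Pair m ↔ Pair M → 2 ≤ M → m ≡ M
  vertexCount {m} {M} σ 2≤M =
    pairs-injective 2≤M (↔⇒≡ (↔-trans (↔-sym (Pair↔Fin-pairs m)) (↔-trans σ (Pair↔Fin-pairs M))))

  module _ {m : ℕ} {A : Set} where

    symmetrise : (Pair m → A) → A → Fin m → Fin m → A
    symmetrise f d u v with <-cmp u v
    ... | tri< u<v _ _ = f ((u , v) , u<v)
    ... | tri≈ _ _ _   = d
    ... | tri> _ _ v<u = f ((v , u) , v<u)

    symmetrise-sym : ∀ f d u v → symmetrise f d u v ≡ symmetrise f d v u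
    symmetrise-sym f d u v with <-cmp u v | <-cmp v u
    ... | tri< u<v _ _ | tri> _ _ u<v′ = cong (λ lt → f ((u , v) , lt)) (<-irrelevant u<v u<v′)
    ... | tri≈ _ _ _   | tri≈ _ _ _    = refl
    ... | tri> _ _ v<u | tri< v<u′ _ _ = cong (λ lt → f ((v , u) , lt)) (<-irrelevant v<u v<u′)
    ... | tri< u<v _ _ | tri< _ _ u≮v  = ⊥-elim (u≮v u<v)
    ... | tri< u<v _ _ | tri≈ _ _ u≮v  = ⊥-elim (u≮v u<v)
    ... | tri≈ _ _ u≮v | tri< u<v _ _  = ⊥-elim (u≮v u<v)
    ... | tri≈ v≮u _ _ | tri> _ _ v<u  = ⊥-elim (v≮u v<u)
    ... | tri> _ _ v<u | tri≈ v≮u _ _  = ⊥-elim (v≮u v<u)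
    ... | tri> v≮u _ _ | tri> _ _ v<u  = ⊥-elim (v≮u v<u)

    symmetrise-diag : ∀ f d u → symmetrise f d u u ≡ d
    symmetrise-diag f d u with <-cmp u u
    ... | tri< u<u _ _ = ⊥-elim (ℕ.<-irrefl refl u<u)
    ... | tri≈ _ _ _   = refl
    ... | tri> _ _ u<u = ⊥-elim (ℕ.<-irrefl refl u<u)

  symmetrise-map : ∀ {m} {A B : Set} {f : Pair m → B} {g : Pair m → A} (h : A → B) {d d′ u v} →
    (∀ p → f p ≡ h (g p)) → u ≢ v → symmetrise f d′ u v ≡ h (symmetrise g d u v)
  symmetrise-map h {u = u} {v} f≡hg u≢v with <-cmp u v
  ... | tri< u<v _ _ = f≡hg _
  ... | tri≈ _ u≡v _ = ⊥-elim (u≢v u≡v)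
  ... | tri> _ _ v<u = f≡hg _

module Electrical where

  open import Defs hiding (sym)
  open Combinatorics using (𝟙ℕ; sum; sum-syntax; symmetrise; inA-↑ˡ; inA-↑ʳ)
  open import Data.Nat as ℕ using (ℕ; zero; suc)
  open import Data.Fin as Fin using (Fin; _≟_; _↑ˡ_; _↑ʳ_)
  open import Data.Fin.Properties using (<-cmp)
  open import Data.Bool using (Bool; true; false; if_then_else_; not; _xor_)
  open import Data.Bool.Properties using (xor-comm; true-xor)
  open import Data.Rational using (ℚ; 0ℚ; 1ℚ; ½; _+_; _*_; _-_; -_; 1/_; NonZero; Positive; NonNegative)
  open import Data.Rational.Properties
    using ( *-identityˡ; *-inverseˡ; +-identityʳ; +-identityˡ; *-zeroˡ; <⇒≢; positive⁻¹
          ; pos⇒nonZero; pos*pos⇒pos; pos+nonNeg⇒pos; nonNeg+nonNeg⇒nonNeg )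
  open import Data.Rational.Solver using (module +-*-Solver)
  open import Relation.Binary using (tri<; tri≈; tri>)
  open import Relation.Binary.PropositionalEquality
    using (_≡_; _≢_; refl; sym; trans; cong; cong₂; subst; module ≡-Reasoning)
  open import Relation.Nullary using (yes; no)
  open import Data.Empty using (⊥-elim)
  open import Data.Maybe using (just)
  open import Data.Product using (_,_)
  open import Function using (_∘_)
  open +-*-Solver

  𝟙ℚ : Bool → ℚ
  𝟙ℚ true  = 1ℚ
  𝟙ℚ false = 0ℚ

  if-then-0 : ∀ b t → (if b then t else 0ℚ) ≡ 𝟙ℚ b * t
  if-then-0 true  t = sym (*-identityˡ t)
  if-then-0 false t = solve 1 (λ t → con 0ℚ := con 0ℚ :* t) refl t

  δ-diag : ∀ {n} (u : Fin n) → δ u u ≡ 1ℚ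
  δ-diag Fin.zero    = refl
  δ-diag (Fin.suc u) = δ-diag u

  δ-off : ∀ {n} {u w : Fin n} → w ≢ u → δ u w ≡ 0ℚ
  δ-off {u = u} {w} w≢u with w ≟ u
  ... | yes w≡u = ⊥-elim (w≢u w≡u)
  ... | no  _   = refl

  δ-weight : ∀ {n} (f : Fin n → ℚ) (i w : Fin n) → f w * δ i w ≡ f i * δ i w
  δ-weight f i w with w ≟ i
  ... | yes refl = refl
  ... | no  _    = solve 2 (λ x y → x :* con 0ℚ := y :* con 0ℚ) refl (f w) (f i)

  sumFin-cong : ∀ n {f g : Fin n → ℚ} → (∀ i → f i ≡ g i) → sumFin n f ≡ sumFin n g
  sumFin-cong zero    f≗g = refl
  sumFin-cong (suc n) f≗g = cong₂ _+_ (f≗g Fin.zero) (sumFin-cong n (λ i → f≗g (Fin.suc i)))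

  sumFin-zero : ∀ n → sumFin n (λ _ → 0ℚ) ≡ 0ℚ
  sumFin-zero zero    = refl
  sumFin-zero (suc n) = cong (0ℚ +_) (sumFin-zero n)

  sumFin-distrib-+ : ∀ n (f g : Fin n → ℚ) →
    sumFin n (λ i → f i + g i) ≡ sumFin n f + sumFin n g
  sumFin-distrib-+ zero    f g = refl
  sumFin-distrib-+ (suc n) f g =
    trans (cong (f Fin.zero + g Fin.zero +_) (sumFin-distrib-+ n (λ i → f (Fin.suc i)) (λ i → g (Fin.suc i))))
          (solve 4 (λ a b c d → (a :+ b) :+ (c :+ d) := (a :+ c) :+ (b :+ d)) refl
                 (f Fin.zero) (g Fin.zero) (sumFin n (λ i → f (Fin.suc i))) (sumFin n (λ i → g (Fin.suc i))))

  sumFin-distrib-minus : ∀ n (f g : Fin n → ℚ) →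
    sumFin n (λ i → f i - g i) ≡ sumFin n f - sumFin n g
  sumFin-distrib-minus zero    f g = refl
  sumFin-distrib-minus (suc n) f g =
    trans (cong (f Fin.zero - g Fin.zero +_) (sumFin-distrib-minus n (λ i → f (Fin.suc i)) (λ i → g (Fin.suc i))))
          (solve 4 (λ a b c d → (a :- b) :+ (c :- d) := (a :+ c) :- (b :+ d)) refl
                 (f Fin.zero) (g Fin.zero) (sumFin n (λ i → f (Fin.suc i))) (sumFin n (λ i → g (Fin.suc i))))

  sumFin-*ˡ : ∀ n c (f : Fin n → ℚ) → sumFin n (λ i → c * f i) ≡ c * sumFin n f
  sumFin-*ˡ zero    c f = solve 1 (λ c → con 0ℚ := c :* con 0ℚ) refl c
  sumFin-*ˡ (suc n) c f =
    trans (cong (c * f Fin.zero +_) (sumFin-*ˡ n c (λ i → f (Fin.suc i))))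
          (solve 3 (λ c a b → c :* a :+ c :* b := c :* (a :+ b)) refl c (f Fin.zero) (sumFin n (λ i → f (Fin.suc i))))

  sumFin-comm : ∀ m n (f : Fin m → Fin n → ℚ) →
    sumFin m (λ i → sumFin n (f i)) ≡ sumFin n (λ j → sumFin m (λ i → f i j))
  sumFin-comm zero    n f = sym (sumFin-zero n)
  sumFin-comm (suc m) n f =
    trans (cong (sumFin n (f Fin.zero) +_) (sumFin-comm m n (λ i → f (Fin.suc i))))
          (sym (sumFin-distrib-+ n _ _))

  sumFin-δ : ∀ n (f : Fin n → ℚ) u → sumFin n (λ i → f i * δ u i) ≡ f u
  sumFin-δ (suc n) f Fin.zero =
    trans (cong (f Fin.zero * 1ℚ +_)
            (trans (sumFin-cong n (λ i → solve 1 (λ x → x :* con 0ℚ := con 0ℚ) refl (f (Fin.suc i))))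
                   (sumFin-zero n)))
          (solve 1 (λ x → x :* con 1ℚ :+ con 0ℚ := x) refl (f Fin.zero))
  sumFin-δ (suc n) f (Fin.suc u) =
    trans (cong (f Fin.zero * 0ℚ +_) (sumFin-δ n (λ i → f (Fin.suc i)) u))
          (solve 2 (λ x y → x :* con 0ℚ :+ y := y) refl (f Fin.zero) (f (Fin.suc u)))

  sumFin-++ : ∀ a b (f : Fin (a ℕ.+ b) → ℚ) →
    sumFin (a ℕ.+ b) f ≡ sumFin a (λ i → f (i ↑ˡ b)) + sumFin b (λ j → f (a ↑ʳ j))
  sumFin-++ zero    b f = solve 1 (λ x → x := con 0ℚ :+ x) refl (sumFin b f)
  sumFin-++ (suc a) b f =
    trans (cong (f Fin.zero +_) (sumFin-++ a b (λ i → f (Fin.suc i))))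
          (solve 3 (λ x y z → x :+ (y :+ z) := (x :+ y) :+ z) refl
                 (f Fin.zero) (sumFin a (λ i → f (Fin.suc (i ↑ˡ b)))) (sumFin b (λ j → f (Fin.suc (a ↑ʳ j)))))

  fromℕ : ℕ → ℚ
  fromℕ zero    = 0ℚ
  fromℕ (suc k) = 1ℚ + fromℕ k

  sumFin-const : ∀ n c → sumFin n (λ _ → c) ≡ fromℕ n * c
  sumFin-const zero    c = solve 1 (λ c → con 0ℚ := con 0ℚ :* c) refl c
  sumFin-const (suc n) c =
    trans (cong (c +_) (sumFin-const n c))
          (solve 2 (λ c k → c :+ k :* c := (con 1ℚ :+ k) :* c) refl c (fromℕ n))

  fromℕ-+ : ∀ a b → fromℕ (a ℕ.+ b) ≡ fromℕ a + fromℕ b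
  fromℕ-+ zero    b = sym (+-identityˡ (fromℕ b))
  fromℕ-+ (suc a) b = trans (cong (1ℚ +_) (fromℕ-+ a b))
                            (solve 2 (λ x y → con 1ℚ :+ (x :+ y) := (con 1ℚ :+ x) :+ y) refl (fromℕ a) (fromℕ b))

  fromℕ-* : ∀ a b → fromℕ (a ℕ.* b) ≡ fromℕ a * fromℕ b
  fromℕ-* zero    b = sym (*-zeroˡ (fromℕ b))
  fromℕ-* (suc a) b = trans (fromℕ-+ b (a ℕ.* b)) (trans (cong (fromℕ b +_) (fromℕ-* a b))
                        (solve 2 (λ x y → y :+ x :* y := (con 1ℚ :+ x) :* y) refl (fromℕ a) (fromℕ b)))

  fromℕ-nonNegative : ∀ n → NonNegative (fromℕ n)
  fromℕ-nonNegative zero    = _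
  fromℕ-nonNegative (suc n) = nonNeg+nonNeg⇒nonNeg 1ℚ (fromℕ n) {{fromℕ-nonNegative n}}

  fromℕ-positive : ∀ n .{{_ : ℕ.NonZero n}} → Positive (fromℕ n)
  fromℕ-positive (suc n) = pos+nonNeg⇒pos 1ℚ (fromℕ n) {{fromℕ-nonNegative n}}

  fromℕ-injective : ∀ {a b} → fromℕ a ≡ fromℕ b → a ≡ b
  fromℕ-injective {zero}  {zero}  _ = refl
  fromℕ-injective {zero}  {suc b} e = ⊥-elim (<⇒≢ (positive⁻¹ (fromℕ (suc b)) {{fromℕ-positive (suc b)}}) e)
  fromℕ-injective {suc a} {zero}  e = ⊥-elim (<⇒≢ (positive⁻¹ (fromℕ (suc a)) {{fromℕ-positive (suc a)}}) (sym e))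
  fromℕ-injective {suc a} {suc b} e = cong suc (fromℕ-injective (begin
    fromℕ a                    ≡⟨ solve 1 (λ x → x := con (- 1ℚ) :+ (con 1ℚ :+ x)) refl (fromℕ a) ⟩
    - 1ℚ + (1ℚ + fromℕ a)      ≡⟨ cong (- 1ℚ +_) e ⟩
    - 1ℚ + (1ℚ + fromℕ b)      ≡⟨ solve 1 (λ x → con (- 1ℚ) :+ (con 1ℚ :+ x) := x) refl (fromℕ b) ⟩
    fromℕ b                    ∎))
    where open ≡-Reasoning

  fromℕ-∑ : ∀ {m} (f : Fin m → ℕ) → fromℕ (∑[ x < m ] f x) ≡ sumFin m (λ x → fromℕ (f x))
  fromℕ-∑ {zero}  f = refl
  fromℕ-∑ {suc m} f = trans (fromℕ-+ (f Fin.zero) _) (cong (fromℕ (f Fin.zero) +_) (fromℕ-∑ (λ x → f (Fin.suc x))))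

  𝟙ℚ-fromℕ : ∀ b → 𝟙ℚ b ≡ fromℕ (𝟙ℕ b)
  𝟙ℚ-fromℕ true  = sym (+-identityʳ 1ℚ)
  𝟙ℚ-fromℕ false = refl

  module _ {n : ℕ} (G : Graph n) where

    private
      a : Fin n → Fin n → ℚ
      a w x = 𝟙ℚ (adj G w x)

    ⟨_,_⟩ : (Fin n → ℚ) → (Fin n → ℚ) → ℚ
    ⟨ φ , ψ ⟩ = sumFin n (λ w → φ w * ψ w)

    degreeForm adjacencyForm : (Fin n → ℚ) → (Fin n → ℚ) → ℚ
    degreeForm    φ ψ = sumFin n (λ w → sumFin n (λ x → a w x * (φ w * ψ w)))
    adjacencyForm φ ψ = sumFin n (λ w → sumFin n (λ x → a w x * (φ w * ψ x)))

    degreeForm-comm : ∀ φ ψ → degreeForm φ ψ ≡ degreeForm ψ φ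
    degreeForm-comm φ ψ = sumFin-cong n (λ w → sumFin-cong n (λ x →
      solve 3 (λ a p q → a :* (p :* q) := a :* (q :* p)) refl (a w x) (φ w) (ψ w)))

    adjacencyForm-comm : ∀ φ ψ → adjacencyForm φ ψ ≡ adjacencyForm ψ φ
    adjacencyForm-comm φ ψ = trans (sumFin-comm n n _) (sumFin-cong n (λ x → sumFin-cong n (λ w →
      trans (cong (λ b → 𝟙ℚ b * (φ w * ψ x)) (Graph.sym G w x))
            (solve 3 (λ a p q → a :* (p :* q) := a :* (q :* p)) refl (a x w) (φ w) (ψ x)))))

    lap-as-sum : ∀ φ w → lap G φ w ≡ sumFin n (λ x → a w x * (φ w - φ x))
    lap-as-sum φ w = sumFin-cong n (λ x → if-then-0 (adj G w x) (φ w - φ x))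

    inner-lap : ∀ φ ψ → ⟨ φ , lap G ψ ⟩ ≡ degreeForm φ ψ - adjacencyForm φ ψ
    inner-lap φ ψ = begin
        sumFin n (λ w → φ w * lap G ψ w)
      ≡⟨ sumFin-cong n (λ w → trans (cong (φ w *_) (lap-as-sum ψ w)) (sym (sumFin-*ˡ n (φ w) _))) ⟩
        sumFin n (λ w → sumFin n (λ x → φ w * (a w x * (ψ w - ψ x))))
      ≡⟨ sumFin-cong n (λ w → trans (sumFin-cong n (λ x →
            solve 4 (λ p a s t → p :* (a :* (s :- t)) := a :* (p :* s) :- a :* (p :* t)) refl
              (φ w) (a w x) (ψ w) (ψ x)))
            (sumFin-distrib-minus n _ _)) ⟩
        sumFin n (λ w → sumFin n (λ x → a w x * (φ w * ψ w)) - sumFin n (λ x → a w x * (φ w * ψ x)))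
      ≡⟨ sumFin-distrib-minus n _ _ ⟩
        degreeForm φ ψ - adjacencyForm φ ψ ∎
      where open ≡-Reasoning

    inner-lap-comm : ∀ φ ψ → ⟨ φ , lap G ψ ⟩ ≡ ⟨ ψ , lap G φ ⟩
    inner-lap-comm φ ψ = begin
      ⟨ φ , lap G ψ ⟩                       ≡⟨ inner-lap φ ψ ⟩
      degreeForm φ ψ - adjacencyForm φ ψ    ≡⟨ cong₂ _-_ (degreeForm-comm φ ψ) (adjacencyForm-comm φ ψ) ⟩
      degreeForm ψ φ - adjacencyForm ψ φ    ≡⟨ sym (inner-lap ψ φ) ⟩
      ⟨ ψ , lap G φ ⟩                       ∎
      where open ≡-Reasoning

    inner-lap-potential : ∀ {c d} φ ψ → IsPotential G c d ψ → ⟨ φ , lap G ψ ⟩ ≡ φ c - φ d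
    inner-lap-potential {c} {d} φ ψ ψ-pot = begin
        sumFin n (λ w → φ w * lap G ψ w)
      ≡⟨ sumFin-cong n (λ w → cong (φ w *_) (ψ-pot w)) ⟩
        sumFin n (λ w → φ w * (δ c w - δ d w))
      ≡⟨ sumFin-cong n (λ w → solve 3 (λ p x y → p :* (x :- y) := p :* x :- p :* y) refl (φ w) (δ c w) (δ d w)) ⟩
        sumFin n (λ w → φ w * δ c w - φ w * δ d w)
      ≡⟨ sumFin-distrib-minus n _ _ ⟩
        sumFin n (λ w → φ w * δ c w) - sumFin n (λ w → φ w * δ d w)
      ≡⟨ cong₂ _-_ (sumFin-δ n φ c) (sumFin-δ n φ d) ⟩
        φ c - φ d ∎
      where open ≡-Reasoning

    reciprocity : ∀ {p q c d} φ ψ → IsPotential G p q φ → IsPotential G c d ψ →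
                  φ c - φ d ≡ ψ p - ψ q
    reciprocity {p} {q} {c} {d} φ ψ φ-pot ψ-pot = begin
      φ c - φ d        ≡⟨ sym (inner-lap-potential φ ψ ψ-pot) ⟩
      ⟨ φ , lap G ψ ⟩  ≡⟨ inner-lap-comm φ ψ ⟩
      ⟨ ψ , lap G φ ⟩  ≡⟨ inner-lap-potential ψ φ φ-pot ⟩
      ψ p - ψ q        ∎
      where open ≡-Reasoning

    lap-*ˡ : ∀ k φ w → lap G (λ x → k * φ x) w ≡ k * lap G φ w
    lap-*ˡ k φ w = begin
        sumFin n (λ x → if adj G w x then k * φ w - k * φ x else 0ℚ)
      ≡⟨ sumFin-cong n (λ x → trans (if-then-0 (adj G w x) _)
           (solve 4 (λ a k p q → a :* (k :* p :- k :* q) := k :* (a :* (p :- q))) refl (a w x) k (φ w) (φ x))) ⟩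
        sumFin n (λ x → k * (a w x * (φ w - φ x)))
      ≡⟨ sumFin-*ˡ n k _ ⟩
        k * sumFin n (λ x → a w x * (φ w - φ x))
      ≡⟨ cong (k *_) (sym (lap-as-sum φ w)) ⟩
        k * lap G φ w ∎
      where open ≡-Reasoning

    potential-refl : ∀ u → IsPotential G u u (λ _ → 0ℚ)
    potential-refl u w = begin
      sumFin n (λ x → if adj G w x then 0ℚ - 0ℚ else 0ℚ)  ≡⟨ sumFin-cong n (λ x → if-0 (adj G w x)) ⟩
      sumFin n (λ _ → 0ℚ)                                  ≡⟨ sumFin-zero n ⟩
      0ℚ                                                   ≡⟨ solve 1 (λ d → con 0ℚ := d :- d) refl (δ u w) ⟩
      δ u w - δ u w                                        ∎
      where
      open ≡-Reasoning
      if-0 : ∀ b → (if b then 0ℚ - 0ℚ else 0ℚ) ≡ 0ℚ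
      if-0 true  = refl
      if-0 false = refl

    potential-swap : ∀ {u v} φ → IsPotential G u v φ → IsPotential G v u (λ x → - φ x)
    potential-swap {u} {v} φ φ-pot w = begin
      lap G (λ x → - φ x) w          ≡⟨ sumFin-cong n (λ x → cong (λ t → if adj G w x then t else 0ℚ)
                                          (solve 2 (λ p q → :- p :- :- q := con (- 1ℚ) :* p :- con (- 1ℚ) :* q) refl (φ w) (φ x))) ⟩
      lap G (λ x → - 1ℚ * φ x) w     ≡⟨ lap-*ˡ (- 1ℚ) φ w ⟩
      - 1ℚ * lap G φ w               ≡⟨ cong (- 1ℚ *_) (φ-pot w) ⟩
      - 1ℚ * (δ u w - δ v w)         ≡⟨ solve 2 (λ p q → con (- 1ℚ) :* (p :- q) := q :- p) refl (δ u w) (δ v w) ⟩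
      δ v w - δ u w                  ∎
      where open ≡-Reasoning

    degreeℚ : Fin n → ℚ
    degreeℚ w = sumFin n (λ x → 𝟙ℚ (adj G w x))

    lap-expand : ∀ φ w → lap G φ w ≡ degreeℚ w * φ w - sumFin n (λ x → 𝟙ℚ (adj G w x) * φ x)
    lap-expand φ w = begin
        lap G φ w
      ≡⟨ lap-as-sum φ w ⟩
        sumFin n (λ x → 𝟙ℚ (adj G w x) * (φ w - φ x))
      ≡⟨ sumFin-cong n (λ x → solve 3 (λ a p q → a :* (p :- q) := p :* a :- a :* q) refl (𝟙ℚ (adj G w x)) (φ w) (φ x)) ⟩
        sumFin n (λ x → φ w * 𝟙ℚ (adj G w x) - 𝟙ℚ (adj G w x) * φ x)
      ≡⟨ sumFin-distrib-minus n _ _ ⟩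
        sumFin n (λ x → φ w * 𝟙ℚ (adj G w x)) - sumFin n (λ x → 𝟙ℚ (adj G w x) * φ x)
      ≡⟨ cong (_- sumFin n (λ x → 𝟙ℚ (adj G w x) * φ x))
           (trans (sumFin-*ˡ n (φ w) _) (solve 2 (λ p d → p :* d := d :* p) refl (φ w) (degreeℚ w))) ⟩
        degreeℚ w * φ w - sumFin n (λ x → 𝟙ℚ (adj G w x) * φ x) ∎
      where open ≡-Reasoning

    lap-δ : ∀ i w → lap G (δ i) w ≡ degreeℚ w * δ i w - 𝟙ℚ (adj G w i)
    lap-δ i w = trans (lap-expand (δ i) w) (cong (λ t → degreeℚ w * δ i w - t) (sumFin-δ n (λ x → 𝟙ℚ (adj G w x)) i))

    lap-+ : ∀ φ ψ w → lap G (λ x → φ x + ψ x) w ≡ lap G φ w + lap G ψ w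
    lap-+ φ ψ w = trans
      (sumFin-cong n (λ x → trans (if-then-0 (adj G w x) _)
        (solve 5 (λ a p q r s → a :* ((p :+ r) :- (q :+ s)) := a :* (p :- q) :+ a :* (r :- s)) refl
          (𝟙ℚ (adj G w x)) (φ w) (φ x) (ψ w) (ψ x))))
      (trans (sumFin-distrib-+ n _ _) (sym (cong₂ _+_ (lap-as-sum φ w) (lap-as-sum ψ w))))

    resistance-of-scaledPotential : ∀ {i j} Φ c .{{_ : NonZero c}} →
      (∀ w → lap G Φ w ≡ c * (δ i w - δ j w)) → Resistance G i j (just ((1/ c) * (Φ i - Φ j)))
    resistance-of-scaledPotential {i} {j} Φ c lapΦ =
      (λ x → (1/ c) * Φ x) , potential ,
      solve 3 (λ k p q → k :* p :- k :* q := k :* (p :- q)) refl (1/ c) (Φ i) (Φ j)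
      where
      open ≡-Reasoning
      potential : IsPotential G i j (λ x → (1/ c) * Φ x)
      potential w = begin
        lap G (λ x → (1/ c) * Φ x) w     ≡⟨ lap-*ˡ (1/ c) Φ w ⟩
        (1/ c) * lap G Φ w               ≡⟨ cong ((1/ c) *_) (lapΦ w) ⟩
        (1/ c) * (c * (δ i w - δ j w))   ≡⟨ solve 3 (λ k c d → k :* (c :* d) := (k :* c) :* d) refl (1/ c) c (δ i w - δ j w) ⟩
        (1/ c) * c * (δ i w - δ j w)     ≡⟨ cong (_* (δ i w - δ j w)) (*-inverseˡ c) ⟩
        1ℚ * (δ i w - δ j w)             ≡⟨ *-identityˡ _ ⟩
        δ i w - δ j w                    ∎

  resistance-sym : ∀ {n} {G : Graph n} {u v r} → Resistance G u v (just r) → Resistance G v u (just r)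
  resistance-sym {G = G} {u} {v} {r} (φ , φ-pot , φu-φv≡r) =
    (λ x → - φ x) , potential-swap G φ φ-pot ,
    trans (solve 2 (λ p q → :- q :- :- p := p :- q) refl (φ u) (φ v)) φu-φv≡r

  module PotentialFamily {n : ℕ} (G : Graph n) (P : Fin n → Fin n → Fin n → ℚ)
                         (P-pot : ∀ u v → IsPotential G u v (P u v)) where

    R : Fin n → Fin n → ℚ
    R u v = P u v u - P u v v

    potential-drop : ∀ u v x → (P u v u - P u v x) + (P u v u - P u v x) ≡ R u v + R u x - R x v
    potential-drop u v x = sym (begin
        (a₁ - a₃) + (b₁ - b₂) - (c₂ - c₃)
      ≡⟨ solve 9 (λ a₁ a₂ a₃ b₁ b₂ b₃ c₁ c₂ c₃ →
           (a₁ :- a₃) :+ (b₁ :- b₂) :- (c₂ :- c₃)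
             := ((a₁ :- a₂) :+ (a₂ :- a₃)) :+ ((b₁ :- b₃) :- (b₂ :- b₃)) :- (c₂ :- c₃))
           refl a₁ a₂ a₃ b₁ b₂ b₃ c₁ c₂ c₃ ⟩
        ((a₁ - a₂) + (a₂ - a₃)) + ((b₁ - b₃) - (b₂ - b₃)) - (c₂ - c₃)
      ≡⟨ cong₂ (λ s t → s + t - (c₂ - c₃))
           (cong ((a₁ - a₂) +_) (reciprocity G (P u v) (P x v) (P-pot u v) (P-pot x v)))
           (cong₂ _-_ (sym (reciprocity G (P u v) (P u x) (P-pot u v) (P-pot u x)))
                      (reciprocity G (P u x) (P x v) (P-pot u x) (P-pot x v))) ⟩
        ((a₁ - a₂) + (c₁ - c₃)) + ((a₁ - a₂) - (c₁ - c₂)) - (c₂ - c₃)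
      ≡⟨ solve 4 (λ d c₁ c₂ c₃ → (d :+ (c₁ :- c₃)) :+ (d :- (c₁ :- c₂)) :- (c₂ :- c₃) := d :+ d)
           refl (a₁ - a₂) c₁ c₂ c₃ ⟩
        (a₁ - a₂) + (a₁ - a₂) ∎)
      where
      open ≡-Reasoning
      a₁ = P u v u; a₂ = P u v x; a₃ = P u v v
      b₁ = P u x u; b₂ = P u x x; b₃ = P u x v
      c₁ = P x v u; c₂ = P x v x; c₃ = P x v v

    neighbourSum : ∀ u v → u ≢ v →
      sumFin n (λ x → 𝟙ℚ (adj G u x) * (R u v + R u x - R x v)) ≡ 1ℚ + 1ℚ
    neighbourSum u v u≢v = begin
        sumFin n (λ x → 𝟙ℚ (adj G u x) * (R u v + R u x - R x v))
      ≡⟨ sumFin-cong n (λ x → cong (𝟙ℚ (adj G u x) *_) (sym (potential-drop u v x))) ⟩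
        sumFin n (λ x → 𝟙ℚ (adj G u x) * (drop x + drop x))
      ≡⟨ sumFin-cong n (λ x → solve 2 (λ i t → i :* (t :+ t) := i :* t :+ i :* t) refl (𝟙ℚ (adj G u x)) (drop x)) ⟩
        sumFin n (λ x → 𝟙ℚ (adj G u x) * drop x + 𝟙ℚ (adj G u x) * drop x)
      ≡⟨ sumFin-distrib-+ n _ _ ⟩
        lapAtU + lapAtU
      ≡⟨ cong₂ _+_ current current ⟩
        1ℚ + 1ℚ ∎
      where
      open ≡-Reasoning
      drop : Fin n → ℚ
      drop x = P u v u - P u v x
      lapAtU : ℚ
      lapAtU = sumFin n (λ x → 𝟙ℚ (adj G u x) * drop x)
      current : lapAtU ≡ 1ℚ
      current = begin
        lapAtU                   ≡⟨ sym (lap-as-sum G (P u v) u) ⟩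
        lap G (P u v) u          ≡⟨ P-pot u v u ⟩
        δ u u - δ v u            ≡⟨ cong₂ _-_ (δ-diag u) (δ-off u≢v) ⟩
        1ℚ - 0ℚ                  ≡⟨⟩
        1ℚ                       ∎

    neighbourSum-*ˡ : ∀ k u v → u ≢ v →
      sumFin n (λ x → 𝟙ℚ (adj G u x) * (k * R u v + k * R u x - k * R x v)) ≡ k * (1ℚ + 1ℚ)
    neighbourSum-*ˡ k u v u≢v = begin
        sumFin n (λ x → 𝟙ℚ (adj G u x) * (k * R u v + k * R u x - k * R x v))
      ≡⟨ sumFin-cong n (λ x → solve 5 (λ i k p q r → i :* (k :* p :+ k :* q :- k :* r) := k :* (i :* (p :+ q :- r)))
           refl (𝟙ℚ (adj G u x)) k (R u v) (R u x) (R x v)) ⟩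
        sumFin n (λ x → k * (𝟙ℚ (adj G u x) * (R u v + R u x - R x v)))
      ≡⟨ sumFin-*ˡ n k _ ⟩
        k * sumFin n (λ x → 𝟙ℚ (adj G u x) * (R u v + R u x - R x v))
      ≡⟨ cong (k *_) (neighbourSum u v u≢v) ⟩
        k * (1ℚ + 1ℚ) ∎
      where open ≡-Reasoning

    module IntegralResistances (c : ℕ) (ρ : Fin n → Fin n → ℕ)
                               (cR≡2ρ : ∀ u v → fromℕ c * R u v ≡ fromℕ (ρ u v) + fromℕ (ρ u v)) where

      term : Fin n → Fin n → Fin n → ℚ
      term u v x = fromℕ (𝟙ℕ (adj G u x) ℕ.* (ρ u v ℕ.+ ρ u x)) - fromℕ (𝟙ℕ (adj G u x) ℕ.* ρ x v)

      term-doubled : ∀ u v x →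
        term u v x + term u v x ≡ 𝟙ℚ (adj G u x) * (fromℕ c * R u v + fromℕ c * R u x - fromℕ c * R x v)
      term-doubled u v x = sym (begin
          𝟙ℚ (adj G u x) * (fromℕ c * R u v + fromℕ c * R u x - fromℕ c * R x v)
        ≡⟨ cong₂ _*_ (𝟙ℚ-fromℕ (adj G u x)) (cong₂ _-_ (cong₂ _+_ (cR≡2ρ u v) (cR≡2ρ u x)) (cR≡2ρ x v)) ⟩
          A * ((F₁ + F₁) + (F₂ + F₂) - (F₃ + F₃))
        ≡⟨ solve 4 (λ i p q r → i :* ((p :+ p) :+ (q :+ q) :- (r :+ r)) := (i :* (p :+ q) :- i :* r) :+ (i :* (p :+ q) :- i :* r))
             refl A F₁ F₂ F₃ ⟩
          (A * (F₁ + F₂) - A * F₃) + (A * (F₁ + F₂) - A * F₃)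
        ≡⟨ cong (λ t → t + t) (sym (cong₂ _-_ (trans (fromℕ-* (𝟙ℕ (adj G u x)) _) (cong (A *_) (fromℕ-+ (ρ u v) (ρ u x))))
                                              (fromℕ-* (𝟙ℕ (adj G u x)) (ρ x v)))) ⟩
          term u v x + term u v x ∎)
        where
        open ≡-Reasoning
        A = fromℕ (𝟙ℕ (adj G u x))
        F₁ = fromℕ (ρ u v)
        F₂ = fromℕ (ρ u x)
        F₃ = fromℕ (ρ x v)

      localIdentity : ∀ {u v} → u ≢ v →
        ∑[ x < n ] (𝟙ℕ (adj G u x) ℕ.* (ρ u v ℕ.+ ρ u x)) ≡ c ℕ.+ ∑[ x < n ] (𝟙ℕ (adj G u x) ℕ.* ρ x v)
      localIdentity {u} {v} u≢v = fromℕ-injective (begin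
          fromℕ S₁                              ≡⟨ solve 2 (λ a b → a := con ½ :* ((a :- b) :+ (a :- b)) :+ b) refl (fromℕ S₁) (fromℕ S₂) ⟩
          ½ * (D + D) + fromℕ S₂                ≡⟨ cong (λ t → ½ * t + fromℕ S₂) D+D≡2c ⟩
          ½ * (fromℕ c * (1ℚ + 1ℚ)) + fromℕ S₂  ≡⟨ solve 2 (λ c b → con ½ :* (c :* (con 1ℚ :+ con 1ℚ)) :+ b := c :+ b) refl (fromℕ c) (fromℕ S₂) ⟩
          fromℕ c + fromℕ S₂                    ≡⟨ sym (fromℕ-+ c S₂) ⟩
          fromℕ (c ℕ.+ S₂)                      ∎)
        where
        open ≡-Reasoning
        S₁ = ∑[ x < n ] (𝟙ℕ (adj G u x) ℕ.* (ρ u v ℕ.+ ρ u x))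
        S₂ = ∑[ x < n ] (𝟙ℕ (adj G u x) ℕ.* ρ x v)
        D = fromℕ S₁ - fromℕ S₂
        D+D≡2c : D + D ≡ fromℕ c * (1ℚ + 1ℚ)
        D+D≡2c = begin
          D + D
            ≡⟨ cong (λ t → t + t) (trans (cong₂ _-_ (fromℕ-∑ (λ x → 𝟙ℕ (adj G u x) ℕ.* (ρ u v ℕ.+ ρ u x)))
                                                   (fromℕ-∑ (λ x → 𝟙ℕ (adj G u x) ℕ.* ρ x v)))
                                        (sym (sumFin-distrib-minus n _ _))) ⟩
          sumFin n (term u v) + sumFin n (term u v)
            ≡⟨ sym (sumFin-distrib-+ n (term u v) (term u v)) ⟩
          sumFin n (λ x → term u v x + term u v x)
            ≡⟨ sumFin-cong n (term-doubled u v) ⟩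
          sumFin n (λ x → 𝟙ℚ (adj G u x) * (fromℕ c * R u v + fromℕ c * R u x - fromℕ c * R x v))
            ≡⟨ neighbourSum-*ˡ (fromℕ c) u v u≢v ⟩
          fromℕ c * (1ℚ + 1ℚ) ∎

  module _ {m : ℕ} (G : Graph m) (r : Pair m → ℚ) (r-res : ∀ p → ResPair G p (just (r p))) where

    pairResistance : ∀ u v → Resistance G u v (just (symmetrise r 0ℚ u v))
    pairResistance u v with <-cmp u v
    ... | tri< u<v _ _  = r-res ((u , v) , u<v)
    ... | tri≈ _ refl _ = (λ _ → 0ℚ) , potential-refl G u , refl
    ... | tri> _ _ v<u  = resistance-sym {G = G} (r-res ((v , u) , v<u))

  module CompleteBipartite (a b : ℕ) .{{_ : ℕ.NonZero a}} .{{_ : ℕ.NonZero b}} where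

    #A #B : ℚ
    #A = fromℕ a
    #B = fromℕ b

    N : ℚ
    N = #A * #B

    instance
      N-nonZero : NonZero N
      N-nonZero = pos⇒nonZero N {{pos*pos⇒pos #A {{fromℕ-positive a}} #B {{fromℕ-positive b}}}}

    private
      G : Graph (a ℕ.+ b)
      G = K a b

    ownSize oppositeSize : Fin (a ℕ.+ b) → ℚ
    ownSize      i = if inA a i then #A else #B
    oppositeSize i = if inA a i then #B else #A

    inB : Fin (a ℕ.+ b) → ℚ
    inB x = 𝟙ℚ (not (inA a x))

    sumFin-byPart : (h : Bool → ℚ) → sumFin (a ℕ.+ b) (λ x → h (inA a x)) ≡ #A * h true + #B * h false
    sumFin-byPart h = begin
        sumFin (a ℕ.+ b) (λ x → h (inA a x))
      ≡⟨ sumFin-++ a b _ ⟩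
        sumFin a (λ i → h (inA a (i ↑ˡ b))) + sumFin b (λ j → h (inA a (a ↑ʳ j)))
      ≡⟨ cong₂ _+_ (sumFin-cong a (λ i → cong h (inA-↑ˡ b i))) (sumFin-cong b (λ j → cong h (inA-↑ʳ a j))) ⟩
        sumFin a (λ _ → h true) + sumFin b (λ _ → h false)
      ≡⟨ cong₂ _+_ (sumFin-const a (h true)) (sumFin-const b (h false)) ⟩
        #A * h true + #B * h false ∎
      where open ≡-Reasoning

    degreeℚ-K : ∀ w → degreeℚ G w ≡ oppositeSize w
    degreeℚ-K w = trans (sumFin-byPart (λ t → 𝟙ℚ (inA a w xor t))) (count (inA a w))
      where
      count : ∀ s → #A * 𝟙ℚ (s xor true) + #B * 𝟙ℚ (s xor false) ≡ (if s then #B else #A)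
      count true  = solve 2 (λ x y → x :* con 0ℚ :+ y :* con 1ℚ := y) refl #A #B
      count false = solve 2 (λ x y → x :* con 1ℚ :+ y :* con 0ℚ := x) refl #A #B

    lap-K-δ : ∀ i w → lap G (δ i) w ≡ oppositeSize i * δ i w - 𝟙ℚ (inA a w xor inA a i)
    lap-K-δ i w = begin
      lap G (δ i) w                                         ≡⟨ lap-δ G i w ⟩
      degreeℚ G w * δ i w - 𝟙ℚ (inA a w xor inA a i)          ≡⟨ cong (λ t → t - 𝟙ℚ (inA a w xor inA a i)) (δ-weight (degreeℚ G) i w) ⟩
      degreeℚ G i * δ i w - 𝟙ℚ (inA a w xor inA a i)          ≡⟨ cong (λ d → d * δ i w - 𝟙ℚ (inA a w xor inA a i)) (degreeℚ-K i) ⟩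
      oppositeSize i * δ i w - 𝟙ℚ (inA a w xor inA a i)      ∎
      where open ≡-Reasoning

    lap-K-inB : ∀ w → lap G inB w ≡ #A * 𝟙ℚ (not (inA a w)) - #B * 𝟙ℚ (inA a w)
    lap-K-inB w = begin
        lap G inB w
      ≡⟨ lap-expand G inB w ⟩
        degreeℚ G w * inB w - sumFin (a ℕ.+ b) (λ x → 𝟙ℚ (inA a w xor inA a x) * inB x)
      ≡⟨ cong₂ (λ d s → d * inB w - s) (degreeℚ-K w) (sumFin-byPart (λ t → 𝟙ℚ (inA a w xor t) * 𝟙ℚ (not t))) ⟩
        oppositeSize w * inB w - (#A * (𝟙ℚ (inA a w xor true) * 0ℚ) + #B * (𝟙ℚ (inA a w xor false) * 1ℚ))
      ≡⟨ value (inA a w) ⟩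
        #A * 𝟙ℚ (not (inA a w)) - #B * 𝟙ℚ (inA a w) ∎
      where
      open ≡-Reasoning
      value : ∀ s → (if s then #B else #A) * 𝟙ℚ (not s) - (#A * (𝟙ℚ (s xor true) * 0ℚ) + #B * (𝟙ℚ (s xor false) * 1ℚ))
                    ≡ #A * 𝟙ℚ (not s) - #B * 𝟙ℚ s
      value true  = solve 2 (λ x y → y :* con 0ℚ :- (x :* (con 0ℚ :* con 0ℚ) :+ y :* (con 1ℚ :* con 1ℚ))
                                     := x :* con 0ℚ :- y :* con 1ℚ) refl #A #B
      value false = solve 2 (λ x y → x :* con 1ℚ :- (x :* (con 1ℚ :* con 0ℚ) :+ y :* (con 0ℚ :* con 1ℚ))
                                     := x :* con 1ℚ :- y :* con 0ℚ) refl #A #B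

    ownSize*oppositeSize : ∀ i → ownSize i * oppositeSize i ≡ N
    ownSize*oppositeSize i with inA a i
    ... | true  = refl
    ... | false = solve 2 (λ x y → y :* x := x :* y) refl #A #B

    lap-K-samePart : ∀ {i j} → inA a i ≡ inA a j → ∀ w →
      lap G (λ x → ownSize i * δ i x + (- ownSize i) * δ j x) w ≡ N * (δ i w - δ j w)
    lap-K-samePart {i} {j} same w = begin
        lap G (λ x → s * δ i x + (- s) * δ j x) w
      ≡⟨ trans (lap-+ G (λ x → s * δ i x) (λ x → (- s) * δ j x) w) (cong₂ _+_ (lap-*ˡ G s (δ i) w) (lap-*ˡ G (- s) (δ j) w)) ⟩
        s * lap G (δ i) w + (- s) * lap G (δ j) w
      ≡⟨ cong₂ (λ p q → s * p + (- s) * q) (lap-K-δ i w)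
           (trans (lap-K-δ j w) (cong (λ t → (if t then #B else #A) * δ j w - 𝟙ℚ (inA a w xor t)) (sym same))) ⟩
        s * (oppositeSize i * δ i w - X) + (- s) * (oppositeSize i * δ j w - X)
      ≡⟨ solve 5 (λ s o p q x → s :* (o :* p :- x) :+ (:- s) :* (o :* q :- x) := (s :* o) :* (p :- q))
           refl s (oppositeSize i) (δ i w) (δ j w) X ⟩
        ownSize i * oppositeSize i * (δ i w - δ j w)
      ≡⟨ cong (_* (δ i w - δ j w)) (ownSize*oppositeSize i) ⟩
        N * (δ i w - δ j w) ∎
      where
      open ≡-Reasoning
      s = ownSize i
      X = 𝟙ℚ (inA a w xor inA a i)

    lap-K-cross : ∀ {i j} → inA a i ≡ true → inA a j ≡ false → ∀ w →
      lap G (λ x → #A * δ i x + (inB x + (- #B) * δ j x)) w ≡ N * (δ i w - δ j w)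
    lap-K-cross {i} {j} i∈A j∈B w = begin
        lap G (λ x → #A * δ i x + (inB x + (- #B) * δ j x)) w
      ≡⟨ trans (lap-+ G (λ x → #A * δ i x) (λ x → inB x + (- #B) * δ j x) w) (cong₂ _+_ (lap-*ˡ G #A (δ i) w)
           (trans (lap-+ G inB (λ x → (- #B) * δ j x) w) (cong (lap G inB w +_) (lap-*ˡ G (- #B) (δ j) w)))) ⟩
        #A * lap G (δ i) w + (lap G inB w + (- #B) * lap G (δ j) w)
      ≡⟨ cong₂ (λ p q → #A * p + q)
           (trans (lap-K-δ i w) (cong₂ (λ t u → (if t then #B else #A) * δ i w - 𝟙ℚ u) i∈A
             (trans (cong (inA a w xor_) i∈A) (trans (xor-comm (inA a w) true) (true-xor (inA a w))))))
           (cong₂ (λ p q → p + (- #B) * q) (lap-K-inB w)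
             (trans (lap-K-δ j w) (cong₂ (λ t u → (if t then #B else #A) * δ j w - 𝟙ℚ u) j∈B
               (trans (cong (inA a w xor_) j∈B) (xor-comm (inA a w) false))))) ⟩
        #A * (#B * δ i w - 𝟙ℚ (not (inA a w))) + ((#A * 𝟙ℚ (not (inA a w)) - #B * 𝟙ℚ (inA a w)) + (- #B) * (#A * δ j w - 𝟙ℚ (inA a w)))
      ≡⟨ solve 6 (λ x y p q u v → x :* (y :* p :- v) :+ ((x :* v :- y :* u) :+ (:- y) :* (x :* q :- u)) := (x :* y) :* (p :- q))
           refl #A #B (δ i w) (δ j w) (𝟙ℚ (inA a w)) (𝟙ℚ (not (inA a w))) ⟩
        N * (δ i w - δ j w) ∎
      where open ≡-Reasoning

    resistance-K-samePart : ∀ {i j} → i ≢ j → inA a i ≡ inA a j →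
      Resistance G i j (just ((1/ N) * (ownSize i + ownSize i)))
    resistance-K-samePart {i} {j} i≢j same =
      subst (λ r → Resistance G i j (just ((1/ N) * r))) drop
        (resistance-of-scaledPotential G Φ N (lap-K-samePart same))
      where
      s = ownSize i
      Φ : Fin (a ℕ.+ b) → ℚ
      Φ x = s * δ i x + (- s) * δ j x
      drop : Φ i - Φ j ≡ s + s
      drop = trans (cong₂ _-_ (cong₂ (λ p q → s * p + (- s) * q) (δ-diag i) (δ-off i≢j))
                              (cong₂ (λ p q → s * p + (- s) * q) (δ-off (i≢j ∘ sym)) (δ-diag j)))
                   (solve 1 (λ s → s :* con 1ℚ :+ (:- s) :* con 0ℚ :- (s :* con 0ℚ :+ (:- s) :* con 1ℚ) := s :+ s) refl s)

    resistance-K-cross : ∀ {i j} → i ≢ j → inA a i ≡ true → inA a j ≡ false →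
      Resistance G i j (just ((1/ N) * (#A + #B - 1ℚ)))
    resistance-K-cross {i} {j} i≢j i∈A j∈B =
      subst (λ r → Resistance G i j (just ((1/ N) * r))) drop
        (resistance-of-scaledPotential G Φ N (lap-K-cross i∈A j∈B))
      where
      Φ : Fin (a ℕ.+ b) → ℚ
      Φ x = #A * δ i x + (inB x + (- #B) * δ j x)
      drop : Φ i - Φ j ≡ #A + #B - 1ℚ
      drop = trans (cong₂ _-_ (cong₂ (λ p q → #A * p + (𝟙ℚ (not (inA a i)) + (- #B) * q)) (δ-diag i) (δ-off i≢j))
                              (cong₂ (λ p q → #A * p + (𝟙ℚ (not (inA a j)) + (- #B) * q)) (δ-off (i≢j ∘ sym)) (δ-diag j)))
             (trans (cong₂ (λ t u → #A * 1ℚ + (𝟙ℚ (not t) + (- #B) * 0ℚ) - (#A * 0ℚ + (𝟙ℚ (not u) + (- #B) * 1ℚ))) i∈A j∈B)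
                    (solve 2 (λ x y → x :* con 1ℚ :+ (con 0ℚ :+ (:- y) :* con 0ℚ) :- (x :* con 0ℚ :+ (con 1ℚ :+ (:- y) :* con 1ℚ))
                                      := x :+ y :- con 1ℚ) refl #A #B))

    scaledResistance : Bool → Bool → ℚ
    scaledResistance true  true  = #A + #A
    scaledResistance false false = #B + #B
    scaledResistance _     _     = #A + #B - 1ℚ

    resistance-K : ∀ {i j} → i ≢ j → Resistance G i j (just ((1/ N) * scaledResistance (inA a i) (inA a j)))
    resistance-K {i} {j} i≢j with inA a i in i∈ | inA a j in j∈
    ... | true  | false = resistance-K-cross i≢j i∈ j∈
    ... | false | true  = resistance-sym {G = G} (resistance-K-cross (i≢j ∘ sym) j∈ i∈)
    ... | true  | true  = subst (λ o → Resistance G i j (just ((1/ N) * (o + o))))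
                                (cong (λ t → if t then #A else #B) i∈)
                                (resistance-K-samePart i≢j (trans i∈ (sym j∈)))
    ... | false | false = subst (λ o → Resistance G i j (just ((1/ N) * (o + o))))
                                (cong (λ t → if t then #A else #B) i∈)
                                (resistance-K-samePart i≢j (trans i∈ (sym j∈)))

module Spectrum where

  open import Defs hiding (sym)
  open Combinatorics
  open Electrical
  open import Data.Nat as ℕ using (ℕ; suc; z≤n; s≤s)
  import Data.Nat.Properties as ℕ
  open import Data.Fin as Fin using (Fin; _≟_)
  open import Data.Fin.Properties using (<⇒≢)
  open import Data.Bool using (Bool; true; false; not; _∧_)
  open import Data.Rational using (ℚ; 0ℚ; 1ℚ; _+_; _*_; 1/_)
  open import Data.Rational.Properties using (*-inverseʳ; *-identityˡ)
  open import Data.Rational.Solver using (module +-*-Solver)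
  open import Data.Maybe using (just)
  open import Data.Product using (_×_; _,_; proj₁; proj₂)
  open import Function.Bundles using (_↔_; Inverse)
  open import Relation.Binary.PropositionalEquality
    using (_≡_; _≢_; refl; sym; trans; cong; cong₂; module ≡-Reasoning)
  open import Relation.Nullary using (yes; no)
  open +-*-Solver

  module _ (k : ℕ) where

    private
      n = suc k

    open CompleteBipartite n (suc n)

    farK : Pair (n ℕ.+ suc n) → Bool
    farK ((i , j) , _) = not (inA n i) ∧ not (inA n j)

    resistanceK : Pair (n ℕ.+ suc n) → ℚ
    resistanceK ((i , j) , _) = (1/ N) * scaledResistance (inA n i) (inA n j)

    resistanceK-correct : ∀ q → ResPair (K n (suc n)) q (just (resistanceK q))
    resistanceK-correct ((i , j) , i<j) = resistance-K (<⇒≢ i<j)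

    resistanceOfClass : Bool → ℚ
    resistanceOfClass b = (1/ N) * (fromℕ (n ℕ.+ 𝟙ℕ b) + fromℕ (n ℕ.+ 𝟙ℕ b))

    resistanceK-level : ∀ q → resistanceK q ≡ resistanceOfClass (farK q)
    resistanceK-level ((i , j) , _) = cong ((1/ N) *_) (scaled (inA n i) (inA n j))
      where
      n+0 : fromℕ n ≡ fromℕ (n ℕ.+ 0)
      n+0 = cong fromℕ (sym (ℕ.+-identityʳ n))
      scaled : ∀ s t → scaledResistance s t ≡ fromℕ (n ℕ.+ 𝟙ℕ (not s ∧ not t)) + fromℕ (n ℕ.+ 𝟙ℕ (not s ∧ not t))
      scaled true  true  = cong₂ _+_ n+0 n+0
      scaled false false = cong₂ _+_ n+1 n+1
        where n+1 = cong fromℕ (ℕ.+-comm 1 n)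
      scaled true  false = trans (solve 1 (λ x → x :+ (con 1ℚ :+ x) :- con 1ℚ := x :+ x) refl (fromℕ n)) (cong₂ _+_ n+0 n+0)
      scaled false true  = trans (solve 1 (λ x → x :+ (con 1ℚ :+ x) :- con 1ℚ := x :+ x) refl (fromℕ n)) (cong₂ _+_ n+0 n+0)

    resistanceOfClass-scaled : ∀ b → fromℕ (n ℕ.* suc n) * resistanceOfClass b ≡ fromℕ (n ℕ.+ 𝟙ℕ b) + fromℕ (n ℕ.+ 𝟙ℕ b)
    resistanceOfClass-scaled b = begin
      fromℕ (n ℕ.* suc n) * ((1/ N) * L)  ≡⟨ cong (_* ((1/ N) * L)) (fromℕ-* n (suc n)) ⟩
      N * ((1/ N) * L)                    ≡⟨ solve 3 (λ a b l → a :* (b :* l) := (a :* b) :* l) refl N (1/ N) L ⟩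
      N * (1/ N) * L                      ≡⟨ cong (_* L) (*-inverseʳ N) ⟩
      1ℚ * L                              ≡⟨ *-identityˡ L ⟩
      L                                   ∎
      where
      open ≡-Reasoning
      L = fromℕ (n ℕ.+ 𝟙ℕ b) + fromℕ (n ℕ.+ 𝟙ℕ b)

  module SameSpectrumAsK (k m : ℕ) (H : Graph m) (σ : Pair m ↔ Pair (suc k ℕ.+ suc (suc k)))
    (sameRS : ∀ p r → (ResPair H p r → ResPair (K (suc k) (suc (suc k))) (Inverse.to σ p) r)
                    × (ResPair (K (suc k) (suc (suc k))) (Inverse.to σ p) r → ResPair H p r)) where

    private
      n = suc k
      r : Pair m → ℚ
      r p = resistanceK k (Inverse.to σ p)
      r-correct : ∀ p → ResPair H p (just (r p))
      r-correct p = proj₂ (sameRS p (just (r p))) (resistanceK-correct k (Inverse.to σ p))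
      P : Fin m → Fin m → Fin m → ℚ
      P u v = proj₁ (pairResistance H r r-correct u v)
      P-pot : ∀ u v → IsPotential H u v (P u v)
      P-pot u v = proj₁ (proj₂ (pairResistance H r r-correct u v))

    vertex-count : m ≡ n ℕ.+ suc n
    vertex-count = vertexCount σ (ℕ.≤-trans (s≤s (s≤s z≤n)) (ℕ.m≤n+m (suc n) n))

    far : Fin m → Fin m → Bool
    far = symmetrise (λ p → farK k (Inverse.to σ p)) false

    far-sym : ∀ u v → far u v ≡ far v u
    far-sym = symmetrise-sym _ false

    far-irrefl : ∀ u → far u u ≡ false
    far-irrefl = symmetrise-diag _ false

    scaledResistance≡level : ∀ u v → fromℕ (n ℕ.* suc n) * PotentialFamily.R H P P-pot u v
                                   ≡ fromℕ (resistanceLevel H n far u v) + fromℕ (resistanceLevel H n far u v)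
    scaledResistance≡level u v with u ≟ v
    ... | yes refl = trans (cong (fromℕ (n ℕ.* suc n) *_) (trans R≡ (symmetrise-diag r 0ℚ u)))
                           (solve 1 (λ c → c :* con 0ℚ := con 0ℚ :+ con 0ℚ) refl (fromℕ (n ℕ.* suc n)))
      where R≡ = proj₂ (proj₂ (pairResistance H r r-correct u u))
    ... | no u≢v = trans (cong (fromℕ (n ℕ.* suc n) *_)
                           (trans (proj₂ (proj₂ (pairResistance H r r-correct u v)))
                                  (symmetrise-map (resistanceOfClass k) (λ p → resistanceK-level k (Inverse.to σ p)) u≢v)))
                         (resistanceOfClass-scaled k (far u v))

    degree-equation : ∀ u v → u ≢ v →
      (n ℕ.+ 𝟙ℕ (far u v)) ℕ.* degree H u ℕ.+ farNeighbours H far u u ℕ.+ n ℕ.* 𝟙ℕ (adj H u v)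
        ≡ n ℕ.* suc n ℕ.+ farNeighbours H far u v
    degree-equation u v u≢v = degreeEquation-of-localIdentity H n far far-sym far-irrefl u≢v
      (PotentialFamily.IntegralResistances.localIdentity H P P-pot (n ℕ.* suc n) (resistanceLevel H n far) scaledResistance≡level u≢v)

open import Defs
open import Data.Nat using (ℕ; suc; _≤_)
open import Data.Product using (_,_)
open Combinatorics using (module DegreeEquation)
open Spectrum using (module SameSpectrumAsK)

theorem3p2 : (n : ℕ) → 1 ≤ n → (m : ℕ) → (H : Graph m) →
    SameRS H (K n (suc n)) → Isomorphic H (K n (suc n))
theorem3p2 (suc k) _ m H (σ , sameRS) =
  DegreeEquation.isomorphic k m H vertex-count far far-sym far-irrefl degree-equation
  where open SameSpectrumAsK k m H σ sameRS
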